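{- Let $\Theta:\mathrm{QSym}^{(\ell)}\to\mathrm{QSym}^{(\ell)}$ be the unique morphism of $\mathbb N^\ell$-graded coalgebras with $\zeta_{\mathcal Q}\circ\Theta=\nu_{\mathcal Q}$. For every vector composition $\mathbf I$, \[\Theta(M_{\mathbf I})=\begin{cases}1&\mathbf I=(),\\(-1)^{\mathrm{len}(\mathbf I)+|\mathbf I|}\,\eta_{\mathrm{odd}(\mathbf I)}&\text{if the last column of }\mathbf I\text{ has odd weight},\\0&\text{otherwise,}\end{cases}\] and, writing $u=\mathrm{cw}(\mathbf I)$ for the coloring word of $\mathbf I$, \[\Theta(F_{\mathbf I})=\sum_{\mathbf J\trianglelefteq\mathbf E_u,\ \mathrm{Pk}(\mathbf I)\subseteq D(\mathbf J)\cup(D(\mathbf J)+1)}2^{\mathrm{len}(\mathbf J)}M_{\mathbf J}.\]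
   Context: Fix $\ell\ge1$; $|\mathbf n|=\sum n_i$; $\mathbf e_c$ are coordinate vectors. Vector composition: sequence $\mathbf I=(\mathbf i_1,\dots,\mathbf i_m)$ of nonzero elements of $\mathbb N^\ell$; $\mathrm{len}(\mathbf I)=m$; $\Sigma\mathbf I=\sum\mathbf i_r$; $|\mathbf I|=|\Sigma\mathbf I|$. $\mathbf J\trianglelefteq\mathbf I$ means $\mathbf J$ is obtained from $\mathbf I$ by adding together groups of consecutive columns. $\mathbf I\preccurlyeq\mathbf J$ means $\mathbf J=\mathbf J_1\cdots\mathbf J_m$ with $\mathbf J_k$ a vector composition with columns summing to $\mathbf i_k$ such that within each $\mathbf J_k$ every index in the support of a column is $\le$ every index in the support of every later column. $D(\mathbf I)=\{|\mathbf i_1|,|\mathbf i_1|+|\mathbf i_2|,\dots,|\mathbf i_1|+\dots+|\mathbf i_{m-1}|\}$; $D+1=\{s+1:s\in D\}$. $\mathrm{Pk}(\mathbf I)=\{|\mathbf i_1|+\dots+|\mathbf i_r|:1\le r\le m-1,\ |\mathbf i_r|\ge2\}$. The coloring word $\mathrm{cw}(\mathbf I)$ is obtained by reading the columns left to right and, within column $\mathbf i_r$, writing $c$ repeated ($c$-th entry of $\mathbf i_r$) times for $c=0,1,\dots,\ell-1$. For a word $u=u_1\cdots u_n$ over $\{0,\dots,\ell-1\}$, $\mathbf E_u=(\mathbf e_{u_1},\dots,\mathbf e_{u_n})$. If the last column of $\mathbf I$ has odd weight, $\mathbf I$ factors uniquely as $\mathbf I=\mathbf I_1\cdots\mathbf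 I_p$ where the last column of each $\mathbf I_j$ has odd weight and all its other columns even weight, and $\mathrm{odd}(\mathbf I)=(\Sigma\mathbf I_1,\dots,\Sigma\mathbf I_p)$. $\mathrm{QSym}^{(\ell)}$: $\mathbb Q$-span of $M_{\mathbf I}=\sum_{j_1<\dots<j_m}\mathbf x_{j_1}^{\mathbf i_1}\cdots\mathbf x_{j_m}^{\mathbf i_m}$ in commuting variables $x_j^{(i)}$ ($\mathbf x_j^{\mathbf n}=\prod_i(x_j^{(i)})^{n_i}$), graded connected Hopf algebra with deconcatenation coproduct and antipode $\mathsf S_{\mathcal Q}$; $F_{\mathbf I}=\sum_{\mathbf I\preccurlyeq\mathbf J}M_{\mathbf J}$; $\eta_{\mathbf I}=\sum_{\mathbf J\trianglelefteq\mathbf I}2^{\mathrm{len}(\mathbf J)}M_{\mathbf J}$. $\zeta_{\mathcal Q}(M_{\mathbf I})=1$ if $\mathrm{len}(\mathbf I)\le1$, else $0$; $\bar\zeta_{\mathcal Q}(h)=(-1)^{|\mathbf n|}\zeta_{\mathcal Q}(h)$ on degree $\mathbf n$; $\nu_{\mathcal Q}=(\bar\zeta_{\mathcal Q}\circ\mathsf S_{\mathcal Q})\,\zeta_{\mathcal Q}$ (convolution), which is a character. Such a $\Theta$ exists and is unique. -}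

module Defs where

open import Data.Nat as ℕ using (ℕ; zero; suc; _<_; _≡ᵇ_; _≤ᵇ_; _∸_; _%_)
open import Data.Fin using (Fin; toℕ)
open import Data.Vec as Vec using (Vec; []; _∷_)
import Data.Vec.Properties as VecP
open import Data.List as List using (List; []; _∷_; _++_; map; concatMap; length; take; drop; foldr; upTo)
import Data.List.Properties as ListP
open import Data.List.Relation.Unary.All using (All)
open import Data.Bool using (Bool; true; false; if_then_else_; _∧_; _∨_; not)
open import Data.Product using (_×_; _,_)
open import Data.Rational as Q using (ℚ; 0ℚ; 1ℚ; _+_; _*_; -_)
open import Relation.Nullary using (does; ¬_)
open import Relation.Binary.PropositionalEquality using (_≡_; _≢_)

Col : ℕ → Set
Col ℓ = Vec ℕ ℓ

-- a raw list of columns; it is a vector composition when all columns are nonzero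
VC : ℕ → Set
VC ℓ = List (Col ℓ)

wt : ∀ {ℓ} → Col ℓ → ℕ
wt = Vec.sum

IsVComp : ∀ {ℓ} → VC ℓ → Set
IsVComp I = All (λ c → 0 < wt c) I

vzero : ∀ {ℓ} → Col ℓ
vzero {ℓ} = Vec.replicate ℓ 0

vadd : ∀ {ℓ} → Col ℓ → Col ℓ → Col ℓ
vadd = Vec.zipWith ℕ._+_

vsub : ∀ {ℓ} → Col ℓ → Col ℓ → Col ℓ
vsub = Vec.zipWith _∸_

vsum : ∀ {ℓ} → VC ℓ → Col ℓ
vsum = foldr vadd vzero

totwt : ∀ {ℓ} → VC ℓ → ℕ
totwt I = foldr ℕ._+_ 0 (map wt I)

isOdd : ℕ → Bool
isOdd n = not ((n % 2) ≡ᵇ 0)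

filterB : ∀ {A : Set} → (A → Bool) → List A → List A
filterB p [] = []
filterB p (x ∷ xs) = if p x then x ∷ filterB p xs else filterB p xs

allB : ∀ {A : Set} → (A → Bool) → List A → Bool
allB p [] = true
allB p (x ∷ xs) = p x ∧ allB p xs

memB : ℕ → List ℕ → Bool
memB n [] = false
memB n (m ∷ ms) = (n ≡ᵇ m) ∨ memB n ms

-- Elements of QSym^(ℓ): finite ℚ-linear combinations of the M_I,
-- represented as lists of (coefficient, index); compared by coefficients.

Lin : ℕ → Set
Lin ℓ = List (ℚ × VC ℓ)

_≟VC_ : ∀ {ℓ} (I J : VC ℓ) → _
_≟VC_ = ListP.≡-dec (VecP.≡-dec ℕ._≟_)

coeff : ∀ {ℓ} → Lin ℓ → VC ℓ → ℚ
coeff [] J = 0ℚ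
coeff ((q , K) ∷ x) J = if does (J ≟VC K) then q + coeff x J else coeff x J

_≈_ : ∀ {ℓ} → Lin ℓ → Lin ℓ → Set
x ≈ y = ∀ J → coeff x J ≡ coeff y J

sumℚ : List ℚ → ℚ
sumℚ = foldr _+_ 0ℚ

M : ∀ {ℓ} → VC ℓ → Lin ℓ
M I = (1ℚ , I) ∷ []

scale : ∀ {ℓ} → ℚ → Lin ℓ → Lin ℓ
scale q = map (λ { (r , K) → (q * r , K) })

linExt : ∀ {ℓ} → (VC ℓ → Lin ℓ) → Lin ℓ → Lin ℓ
linExt f = concatMap (λ { (q , K) → scale q (f K) })

-- quasi-shuffles: M_I M_J = Σ_{K ∈ qsh I J} M_K
qsh : ∀ {ℓ} → VC ℓ → VC ℓ → List (VC ℓ)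
qsh [] J = J ∷ []
qsh (a ∷ I) [] = (a ∷ I) ∷ []
qsh (a ∷ I) (b ∷ J) =
  map (a ∷_) (qsh I (b ∷ J)) ++ (map (b ∷_) (qsh (a ∷ I) J) ++ map (vadd a b ∷_) (qsh I J))

mul : ∀ {ℓ} → Lin ℓ → Lin ℓ → Lin ℓ
mul x y = concatMap (λ { (q , I) → concatMap (λ { (r , J) →
            map (λ K → (q * r , K)) (qsh I J) }) y }) x

-- deconcatenation: Δ M_I = Σ_{(P,Q) ∈ splits I} M_P ⊗ M_Q
splits : ∀ {ℓ} → VC ℓ → List (VC ℓ × VC ℓ)
splits I = map (λ k → (take k I , drop k I)) (upTo (suc (length I)))

-- antipode on the M-basis, from Σ_k M_{I≤k} S(M_{I>k}) = 0 (I ≠ ()),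
-- i.e. S(M_I) = - Σ_{k=1}^{m} M_{take k I} · S(M_{drop k I}); fuel = length
antipodeF : ∀ {ℓ} → ℕ → VC ℓ → Lin ℓ
antipodeF _ [] = M []
antipodeF zero (_ ∷ _) = []
antipodeF (suc n) I@(_ ∷ _) =
  scale (- 1ℚ) (concatMap (λ k → mul (M (take k I)) (antipodeF n (drop k I)))
                          (map suc (upTo (length I))))

antipode : ∀ {ℓ} → VC ℓ → Lin ℓ
antipode I = antipodeF (length I) I

sign : ℕ → ℚ
sign n = if isOdd n then - 1ℚ else 1ℚ

pow2 : ℕ → ℚ
pow2 zero = 1ℚ
pow2 (suc n) = (1ℚ + 1ℚ) * pow2 n

zetaB : ∀ {ℓ} → VC ℓ → ℚ
zetaB I = if length I ≤ᵇ 1 then 1ℚ else 0ℚ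

zeta : ∀ {ℓ} → Lin ℓ → ℚ
zeta x = sumℚ (map (λ { (q , K) → q * zetaB K }) x)

zetaBar : ∀ {ℓ} → Lin ℓ → ℚ
zetaBar x = sumℚ (map (λ { (q , K) → q * (sign (totwt K) * zetaB K) }) x)

epsB : ∀ {ℓ} → VC ℓ → ℚ
epsB [] = 1ℚ
epsB (_ ∷ _) = 0ℚ

-- ν_Q = (ζ̄_Q ∘ S) * ζ_Q (convolution), on M_I
nuB : ∀ {ℓ} → VC ℓ → ℚ
nuB I = sumℚ (map (λ { (P , Q) → zetaBar (antipode P) * zetaB Q }) (splits I))

-- Θ given on the M-basis (extended linearly) is a morphism of
-- ℕ^ℓ-graded coalgebras QSym^(ℓ) → QSym^(ℓ) with ζ_Q ∘ Θ = ν_Q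

record IsTheta {ℓ : ℕ} (Θ : VC ℓ → Lin ℓ) : Set where
  field
    -- Θ(M_I) lies in QSym^(ℓ) (supported on vector compositions)
    supported : ∀ I J → IsVComp I → ¬ IsVComp J → coeff (Θ I) J ≡ 0ℚ
    graded : ∀ I J → IsVComp I → coeff (Θ I) J ≢ 0ℚ → vsum J ≡ vsum I
    counit : ∀ I → IsVComp I → coeff (Θ I) [] ≡ epsB I
    -- comultiplication: Δ ∘ Θ = (Θ ⊗ Θ) ∘ Δ, compared at M_{J1} ⊗ M_{J2}
    comult : ∀ I J₁ J₂ → IsVComp I →
      coeff (Θ I) (J₁ ++ J₂) ≡
        sumℚ (map (λ { (P , Q) → coeff (Θ P) J₁ * coeff (Θ Q) J₂ }) (splits I))
    zetaCond : ∀ I → IsVComp I → zeta (Θ I) ≡ nuB I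

-- all J with J ⊴ K (coarsenings), each listed once
coarsenings : ∀ {ℓ} → VC ℓ → List (VC ℓ)
coarsenings [] = [] ∷ []
coarsenings (a ∷ r) = concatMap (λ c → (a ∷ c) ∷ merge c) (coarsenings r)
  where
  merge : _ → _
  merge [] = []
  merge (b ∷ c) = (vadd a b ∷ c) ∷ []

eta : ∀ {ℓ} → VC ℓ → Lin ℓ
eta K = map (λ J → (pow2 (length J) , J)) (coarsenings K)

lastOdd : ∀ {ℓ} → VC ℓ → Bool
lastOdd [] = false
lastOdd (c ∷ []) = isOdd (wt c)
lastOdd (c ∷ d ∷ r) = lastOdd (d ∷ r)

-- odd(I): factor I = I_1 ⋯ I_p (each block ends with its unique odd-weight column)
oddGo : ∀ {ℓ} → Col ℓ → VC ℓ → VC ℓ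
oddGo acc [] = []
oddGo acc (c ∷ r) = if isOdd (wt c) then vadd acc c ∷ oddGo vzero r else oddGo (vadd acc c) r

oddPart : ∀ {ℓ} → VC ℓ → VC ℓ
oddPart = oddGo vzero

thetaM : ∀ {ℓ} → VC ℓ → Lin ℓ
thetaM [] = M []
thetaM I@(_ ∷ _) =
  if lastOdd I then scale (sign (length I ℕ.+ totwt I)) (eta (oddPart I)) else []

below : ∀ {n} → Vec ℕ n → List (Vec ℕ n)
below [] = [] ∷ []
below (x ∷ v) = concatMap (λ i → map (i ∷_) (below v)) (upTo (suc x))

-- all vector compositions with Σ = v (fuel ≥ |v|)
compsF : ∀ {ℓ} → ℕ → Col ℓ → List (VC ℓ)
compsF zero v = if wt v ≡ᵇ 0 then [] ∷ [] else []
compsF (suc n) v =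
  if wt v ≡ᵇ 0 then [] ∷ []
  else concatMap (λ c → if wt c ≡ᵇ 0 then [] else map (c ∷_) (compsF n (vsub v c))) (below v)

comps : ∀ {ℓ} → Col ℓ → List (VC ℓ)
comps v = compsF (wt v) v

supp : ∀ {ℓ} → Col ℓ → List ℕ
supp {ℓ} c = map toℕ (filterB (λ i → not (Vec.lookup c i ≡ᵇ 0)) (List.allFin ℓ))

orderedB : ∀ {ℓ} → VC ℓ → Bool
orderedB [] = true
orderedB (c ∷ r) =
  allB (λ d → allB (λ a → allB (λ b → a ≤ᵇ b) (supp d)) (supp c)) r ∧ orderedB r

refinements : ∀ {ℓ} → VC ℓ → List (VC ℓ)
refinements = foldr (λ c acc → concatMap (λ Jc → map (Jc ++_) acc) (filterB orderedB (comps c))) ([] ∷ [])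

F : ∀ {ℓ} → VC ℓ → Lin ℓ
F I = map (λ J → (1ℚ , J)) (refinements I)

cw : ∀ {ℓ} → VC ℓ → List (Fin ℓ)
cw {ℓ} = concatMap (λ c → concatMap (λ i → List.replicate (Vec.lookup c i) i) (List.allFin ℓ))

unitCol : ∀ {ℓ} → Fin ℓ → Col ℓ
unitCol i = Vec.tabulate (λ j → if toℕ i ≡ᵇ toℕ j then 1 else 0)

E : ∀ {ℓ} → List (Fin ℓ) → VC ℓ
E = map unitCol

descGo : ∀ {ℓ} → ℕ → VC ℓ → List ℕ
descGo acc [] = []
descGo acc (c ∷ []) = []
descGo acc (c ∷ d ∷ r) = (acc ℕ.+ wt c) ∷ descGo (acc ℕ.+ wt c) (d ∷ r)

D : ∀ {ℓ} → VC ℓ → List ℕ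
D = descGo 0

pkGo : ∀ {ℓ} → ℕ → VC ℓ → List ℕ
pkGo acc [] = []
pkGo acc (c ∷ []) = []
pkGo acc (c ∷ d ∷ r) =
  if 2 ≤ᵇ wt c then (acc ℕ.+ wt c) ∷ pkGo (acc ℕ.+ wt c) (d ∷ r) else pkGo (acc ℕ.+ wt c) (d ∷ r)

Pk : ∀ {ℓ} → VC ℓ → List ℕ
Pk = pkGo 0

thetaF : ∀ {ℓ} → VC ℓ → Lin ℓ
thetaF I =
  map (λ J → (pow2 (length J) , J))
      (filterB (λ J → allB (λ s → memB s (D J) ∨ memB s (map suc (D J))) (Pk I))
               (coarsenings (E (cw I))))

module Submission where

-- Step 1. The axioms of IsTheta determine Θ: comultiplicativity expresses the
--   coefficient of M_{c J} in Θ(M_I) through the coefficients of single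
--   columns M_(c) in Θ of prefixes of I, and those are fixed by gradedness and
--   by ζ_Q ∘ Θ = ν_Q.
-- Step 2. ζ̄_Q is multiplicative on quasi-shuffles, so ζ̄_Q(S(M_P)) = (-1)^{len P + |P|}
--   and ν_Q(M_I) = 2(-1)^{len I + |I|} if the last column of I is odd, 0 otherwise.
-- Step 3. The coefficients of the claimed value thetaM satisfy the same
--   recursion; this is the M-part of the theorem.
-- Steps 4-5. Θ(F_I) = Σ_{I ≼ R} Θ(M_R).  The refinements R of I are the merges
--   of the single letters E_{cw(I)} by 0/1 flag vectors b (cut or merge at each
--   gap) that cut at least between the columns of I; the coarsenings J of a
--   merge are the merges by smaller flag vectors a.
-- Step 6. After exchanging the sums over b and a, the sum over b is an
--   alternating sum which collapses, gap by gap, to a Boolean test on a.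
-- Step 7. That test is the peak condition Pk(I) ⊆ D(J) ∪ (D(J)+1).

open import Defs
open import Data.Nat as ℕ using (ℕ; zero; suc; _≤_; _⊓_; _∸_; _≡ᵇ_; _≤ᵇ_)
import Data.Nat.Properties as NP
open import Data.Nat.DivMod using ([m+n]%n≡m%n)
open import Data.Nat.Tactic.RingSolver using (solve-∀)
open import Data.Fin as Fin using (Fin; toℕ)
open import Data.Vec as Vec using ([]; _∷_)
import Data.Vec.Properties as VecP
open import Data.List as List using (List; []; _∷_; _++_; map; concatMap; length; take; drop; upTo; applyUpTo; replicate; tabulate)
import Data.List.Properties as LP
open import Data.List.Relation.Unary.All as All using (All; []; _∷_)
import Data.List.Relation.Unary.All.Properties as AllP
open import Data.Bool using (Bool; true; false; if_then_else_; _∧_; _∨_; not; T)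
open import Data.Bool.Properties using (∧-identityʳ; ∧-zeroʳ; ∨-identityʳ; ∨-zeroʳ; not-involutive)
open import Data.Product using (_×_; _,_; uncurry; ∃₂)
open import Data.Rational as Q using (ℚ; 0ℚ; 1ℚ; _+_; _*_; -_)
import Data.Rational.Properties as QP
open import Data.Rational.Solver using (module +-*-Solver)
open import Relation.Nullary using (does; ¬_; yes; no)
open import Relation.Nullary.Decidable using (dec-true; dec-false)
open import Relation.Binary.PropositionalEquality
open import Function using (_∘_; case_of_)
open import Data.Empty using (⊥; ⊥-elim)

module S = +-*-Solver

indicator : Bool → ℚ
indicator true = 1ℚ
indicator false = 0ℚ

indicator-∧ : ∀ a b → indicator (a ∧ b) ≡ indicator a * indicator b
indicator-∧ true b = sym (QP.*-identityˡ (indicator b))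
indicator-∧ false b = sym (QP.*-zeroˡ (indicator b))

if-indicator : ∀ (b : Bool) (q : ℚ) → (if b then q else 0ℚ) ≡ indicator b * q
if-indicator true q = sym (QP.*-identityˡ q)
if-indicator false q = sym (QP.*-zeroˡ q)

module _ {A : Set} where

  sum-cong : ∀ (f g : A → ℚ) → (∀ a → f a ≡ g a) → ∀ xs → sumℚ (map f xs) ≡ sumℚ (map g xs)
  sum-cong f g h [] = refl
  sum-cong f g h (x ∷ xs) = cong₂ _+_ (h x) (sum-cong f g h xs)

  sum-cong-All : ∀ {P : A → Set} (f g : A → ℚ) xs → All P xs → (∀ a → P a → f a ≡ g a) →
    sumℚ (map f xs) ≡ sumℚ (map g xs)
  sum-cong-All f g [] [] h = refl
  sum-cong-All f g (x ∷ xs) (px ∷ pxs) h = cong₂ _+_ (h x px) (sum-cong-All f g xs pxs h)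

  sum-map : ∀ {B : Set} (f : B → ℚ) (g : A → B) xs → sumℚ (map f (map g xs)) ≡ sumℚ (map (f ∘ g) xs)
  sum-map f g [] = refl
  sum-map f g (x ∷ xs) = cong (f (g x) +_) (sum-map f g xs)

  sum-zero : ∀ (f : A → ℚ) → (∀ a → f a ≡ 0ℚ) → ∀ xs → sumℚ (map f xs) ≡ 0ℚ
  sum-zero f h [] = refl
  sum-zero f h (x ∷ xs) = cong₂ _+_ (h x) (sum-zero f h xs)

  sum-++ : ∀ (f : A → ℚ) xs ys → sumℚ (map f (xs ++ ys)) ≡ sumℚ (map f xs) + sumℚ (map f ys)
  sum-++ f [] ys = sym (QP.+-identityˡ _)
  sum-++ f (x ∷ xs) ys =
    trans (cong (f x +_) (sum-++ f xs ys)) (sym (QP.+-assoc (f x) (sumℚ (map f xs)) (sumℚ (map f ys))))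

  sum-+ : ∀ (f g : A → ℚ) xs → sumℚ (map (λ a → f a + g a) xs) ≡ sumℚ (map f xs) + sumℚ (map g xs)
  sum-+ f g [] = refl
  sum-+ f g (x ∷ xs) = trans (cong (f x + g x +_) (sum-+ f g xs))
    (S.solve 4 (λ a b c d → a S.:+ b S.:+ (c S.:+ d) S.:= a S.:+ c S.:+ (b S.:+ d)) refl
      (f x) (g x) (sumℚ (map f xs)) (sumℚ (map g xs)))

  sum-scale : ∀ (q : ℚ) (f : A → ℚ) xs → sumℚ (map (λ a → q * f a) xs) ≡ q * sumℚ (map f xs)
  sum-scale q f [] = sym (QP.*-zeroʳ q)
  sum-scale q f (x ∷ xs) = trans (cong (q * f x +_) (sum-scale q f xs)) (sym (QP.*-distribˡ-+ q (f x) _))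

  sum-filter : ∀ (p : A → Bool) (f : A → ℚ) xs →
    sumℚ (map f (filterB p xs)) ≡ sumℚ (map (λ a → indicator (p a) * f a) xs)
  sum-filter p f [] = refl
  sum-filter p f (x ∷ xs) with p x
  ... | true = cong₂ _+_ (sym (QP.*-identityˡ (f x))) (sum-filter p f xs)
  ... | false = trans (sum-filter p f xs) (sym (trans (cong (_+ _) (QP.*-zeroˡ (f x))) (QP.+-identityˡ _)))

sum-concatMap : ∀ {A B : Set} (φ : B → ℚ) (g : A → List B) (ψ : A → ℚ) → (∀ a → sumℚ (map φ (g a)) ≡ ψ a) →
  ∀ xs → sumℚ (map φ (concatMap g xs)) ≡ sumℚ (map ψ xs)
sum-concatMap φ g ψ h [] = refl
sum-concatMap φ g ψ h (x ∷ xs) = trans (sum-++ φ (g x) (concatMap g xs)) (cong₂ _+_ (h x) (sum-concatMap φ g ψ h xs))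

sum-swap : ∀ {A B : Set} (f : A → B → ℚ) xs (ys : List B) →
  sumℚ (map (λ x → sumℚ (map (f x) ys)) xs) ≡ sumℚ (map (λ y → sumℚ (map (λ x → f x y) xs)) ys)
sum-swap f [] ys = sym (sum-zero _ (λ _ → refl) ys)
sum-swap f (x ∷ xs) ys = trans (cong (sumℚ (map (f x) ys) +_) (sum-swap f xs ys))
  (sym (sum-+ (f x) (λ y → sumℚ (map (λ x' → f x' y) xs)) ys))

Σn : (ℕ → ℚ) → ℕ → ℚ
Σn f zero = 0ℚ
Σn f (suc n) = f 0 + Σn (f ∘ suc) n

sum-applyUpTo : ∀ {A : Set} (f : A → ℚ) (g : ℕ → A) n → sumℚ (map f (applyUpTo g n)) ≡ Σn (f ∘ g) n
sum-applyUpTo f g zero = refl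
sum-applyUpTo f g (suc n) = cong (f (g 0) +_) (sum-applyUpTo f (g ∘ suc) n)

Σn-cong : ∀ f g → (∀ j → f j ≡ g j) → ∀ n → Σn f n ≡ Σn g n
Σn-cong f g h zero = refl
Σn-cong f g h (suc n) = cong₂ _+_ (h 0) (Σn-cong (f ∘ suc) (g ∘ suc) (h ∘ suc) n)

Σn-congB : ∀ f g n → (∀ t → t ℕ.< n → f t ≡ g t) → Σn f n ≡ Σn g n
Σn-congB f g zero h = refl
Σn-congB f g (suc n) h = cong₂ _+_ (h 0 (ℕ.s≤s ℕ.z≤n)) (Σn-congB (f ∘ suc) (g ∘ suc) n (λ t lt → h (suc t) (ℕ.s≤s lt)))

Σn-zero : ∀ f → (∀ j → f j ≡ 0ℚ) → ∀ n → Σn f n ≡ 0ℚ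
Σn-zero f h zero = refl
Σn-zero f h (suc n) = cong₂ _+_ (h 0) (Σn-zero (f ∘ suc) (h ∘ suc) n)

Σn-scale : ∀ c f n → Σn (λ j → c * f j) n ≡ c * Σn f n
Σn-scale c f zero = sym (QP.*-zeroʳ c)
Σn-scale c f (suc n) = trans (cong (c * f 0 +_) (Σn-scale c (f ∘ suc) n)) (sym (QP.*-distribˡ-+ c (f 0) (Σn (f ∘ suc) n)))

Σn-last : ∀ f n → Σn f (suc n) ≡ Σn f n + f n
Σn-last f zero = trans (QP.+-identityʳ (f 0)) (sym (QP.+-identityˡ (f 0)))
Σn-last f (suc n) = trans (cong (f 0 +_) (Σn-last (f ∘ suc) n)) (sym (QP.+-assoc (f 0) (Σn (f ∘ suc) n) (f (suc n))))

Σn-split : ∀ f a b → Σn f (a ℕ.+ b) ≡ Σn f a + Σn (λ t → f (a ℕ.+ t)) b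
Σn-split f zero b = sym (QP.+-identityˡ _)
Σn-split f (suc a) b = trans (cong (f 0 +_) (Σn-split (f ∘ suc) a b)) (sym (QP.+-assoc (f 0) (Σn (f ∘ suc) a) _))

sumLin : ∀ {ℓ} → (ℚ → VC ℓ → ℚ) → Lin ℓ → ℚ
sumLin g x = sumℚ (map (uncurry g) x)

coeff-++ : ∀ {ℓ} (x y : Lin ℓ) J → coeff (x ++ y) J ≡ coeff x J + coeff y J
coeff-++ [] y J = sym (QP.+-identityˡ _)
coeff-++ ((q , K) ∷ x) y J with does (J ≟VC K)
... | true = trans (cong (q +_) (coeff-++ x y J)) (sym (QP.+-assoc q _ _))
... | false = coeff-++ x y J

coeff-scale : ∀ {ℓ} q (x : Lin ℓ) J → coeff (scale q x) J ≡ q * coeff x J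
coeff-scale q [] J = sym (QP.*-zeroʳ q)
coeff-scale q ((r , K) ∷ x) J with does (J ≟VC K)
... | true = trans (cong (q * r +_) (coeff-scale q x J)) (sym (QP.*-distribˡ-+ q r _))
... | false = coeff-scale q x J

coeff-linExt : ∀ {ℓ} (f : VC ℓ → Lin ℓ) (x : Lin ℓ) J →
  coeff (linExt f x) J ≡ sumLin (λ q K → q * coeff (f K) J) x
coeff-linExt f [] J = refl
coeff-linExt f ((q , K) ∷ x) J =
  trans (coeff-++ (scale q (f K)) (linExt f x) J)
        (cong₂ _+_ (coeff-scale q (f K) J) (coeff-linExt f x J))

coeff-M : ∀ {ℓ} (I J : VC ℓ) → coeff (M I) J ≡ indicator (does (J ≟VC I))
coeff-M I J with does (J ≟VC I)
... | true = QP.+-identityʳ 1ℚ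
... | false = refl

sumLin-coeff : ∀ {ℓ} (x : Lin ℓ) a → sumLin (λ q K → q * indicator (does (a ≟VC K))) x ≡ coeff x a
sumLin-coeff [] a = refl
sumLin-coeff ((q , K) ∷ x) a with does (a ≟VC K)
... | true = cong₂ _+_ (QP.*-identityʳ q) (sumLin-coeff x a)
... | false = trans (cong (_+ sumLin _ x) (QP.*-zeroʳ q)) (trans (QP.+-identityˡ _) (sumLin-coeff x a))

sumWhere : ∀ {ℓ} → (VC ℓ → Bool) → Lin ℓ → ℚ
sumWhere P = sumLin (λ q K → q * indicator (P K))

-- If every coefficient of x on {P} vanishes, then so does sumWhere P x.
-- (x may list the same M_K several times, so we remove one K at a time.)
sumWhere-vanishes : ∀ {ℓ} (x : Lin ℓ) (P : VC ℓ → Bool) → (∀ K → P K ≡ true → coeff x K ≡ 0ℚ) → sumWhere P x ≡ 0ℚ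
sumWhere-vanishes [] P h = refl
sumWhere-vanishes {ℓ} ((q , K) ∷ x) P h with P K in eqPK
... | false = trans (cong (_+ sumWhere P x) (QP.*-zeroʳ q)) (trans (QP.+-identityˡ _) (sumWhere-vanishes x P h'))
  where
  h' : ∀ K' → P K' ≡ true → coeff x K' ≡ 0ℚ
  h' K' p with K' ≟VC K | h K' p
  ... | yes refl | _ = ⊥-elim (true≢false (trans (sym p) eqPK))
    where true≢false : true ≢ false
          true≢false ()
  ... | no _ | e = e
... | true = goal
  where
  P' : VC ℓ → Bool
  P' K' = P K' ∧ not (does (K ≟VC K'))
  split : ∀ (y : Lin ℓ) → sumWhere P y ≡ sumWhere P' y + coeff y K
  split [] = sym (QP.+-identityˡ 0ℚ)
  split ((r , K') ∷ y) with K ≟VC K'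
  ... | yes refl rewrite eqPK | split y =
    S.solve 3 (λ r a b → r S.:* S.con 1ℚ S.:+ (a S.:+ b) S.:= r S.:* S.con 0ℚ S.:+ a S.:+ (r S.:+ b)) refl r (sumWhere P' y) (coeff y K)
  ... | no ne rewrite ∧-identityʳ (P K') | split y =
    sym (QP.+-assoc (r * indicator (P K')) (sumWhere P' y) (coeff y K))
  h'' : ∀ K' → P' K' ≡ true → coeff x K' ≡ 0ℚ
  h'' K' p with K' ≟VC K
  ... | yes refl rewrite dec-true (K ≟VC K) refl | ∧-zeroʳ (P K) = ⊥-elim (false≢true p)
    where false≢true : false ≢ true
          false≢true ()
  ... | no ne rewrite dec-false (K ≟VC K') (ne ∘ sym) | ∧-identityʳ (P K') =
    subst (λ z → (if z then q + coeff x K' else coeff x K') ≡ 0ℚ) (dec-false (K' ≟VC K) ne) (h K' p)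
  coeffK : q + coeff x K ≡ 0ℚ
  coeffK = subst (λ z → (if z then q + coeff x K else coeff x K) ≡ 0ℚ) (dec-true (K ≟VC K) refl) (h K eqPK)
  goal : q * indicator true + sumWhere P x ≡ 0ℚ
  goal rewrite split x | sumWhere-vanishes x P' h'' =
    trans (S.solve 2 (λ q c → q S.:* S.con 1ℚ S.:+ (S.con 0ℚ S.:+ c) S.:= q S.:+ c) refl q (coeff x K)) coeffK

_≟col_ : ∀ {ℓ} (a b : Col ℓ) → _
_≟col_ = VecP.≡-dec ℕ._≟_

vadd-zeroʳ : ∀ {ℓ} (c : Col ℓ) → vadd c vzero ≡ c
vadd-zeroʳ [] = refl
vadd-zeroʳ (x ∷ c) = cong₂ _∷_ (NP.+-identityʳ x) (vadd-zeroʳ c)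

vadd-zeroˡ : ∀ {ℓ} (c : Col ℓ) → vadd vzero c ≡ c
vadd-zeroˡ [] = refl
vadd-zeroˡ (x ∷ c) = cong (x ∷_) (vadd-zeroˡ c)

vadd-assoc : ∀ {ℓ} (a b c : Col ℓ) → vadd (vadd a b) c ≡ vadd a (vadd b c)
vadd-assoc [] [] [] = refl
vadd-assoc (x ∷ a) (y ∷ b) (z ∷ c) = cong₂ _∷_ (NP.+-assoc x y z) (vadd-assoc a b c)

wt-vadd : ∀ {ℓ} (a b : Col ℓ) → wt (vadd a b) ≡ wt a ℕ.+ wt b
wt-vadd [] [] = refl
wt-vadd (x ∷ a) (y ∷ b) rewrite wt-vadd a b = interchange x y (wt a) (wt b)
  where interchange : ∀ x y p q → x ℕ.+ y ℕ.+ (p ℕ.+ q) ≡ x ℕ.+ p ℕ.+ (y ℕ.+ q)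
        interchange = solve-∀

wt-vzero : ∀ {ℓ} → wt (vzero {ℓ}) ≡ 0
wt-vzero {zero} = refl
wt-vzero {suc ℓ} = wt-vzero {ℓ}

vsum-single : ∀ {ℓ} (c : Col ℓ) → vsum (c ∷ []) ≡ c
vsum-single c = vadd-zeroʳ c

vsum-++ : ∀ {ℓ} (A B : VC ℓ) → vsum (A ++ B) ≡ vadd (vsum A) (vsum B)
vsum-++ [] B = sym (vadd-zeroˡ (vsum B))
vsum-++ (a ∷ A) B = trans (cong (vadd a) (vsum-++ A B)) (sym (vadd-assoc a (vsum A) (vsum B)))

-- Step 1: the axioms determine every coefficient of Θ(M_I)

otherSingleton : ∀ {ℓ} → Col ℓ → VC ℓ → Bool
otherSingleton v [] = false
otherSingleton v (c ∷ []) = not (does ((v ∷ []) ≟VC (c ∷ [])))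
otherSingleton v (_ ∷ _ ∷ _) = false

otherSingleton-self : ∀ {ℓ} (v : Col ℓ) → otherSingleton v (v ∷ []) ≡ false
otherSingleton-self v rewrite dec-true ((v ∷ []) ≟VC (v ∷ [])) refl = refl

zetaB-split : ∀ {ℓ} (v : Col ℓ) (K : VC ℓ) →
  zetaB K ≡ indicator (does ([] ≟VC K)) + indicator (does ((v ∷ []) ≟VC K)) + indicator (otherSingleton v K)
zetaB-split v [] = refl
zetaB-split v (c ∷ []) with does ((v ∷ []) ≟VC (c ∷ []))
... | true = refl
... | false = refl
zetaB-split v (c ∷ d ∷ K) rewrite dec-false ((v ∷ []) ≟VC (c ∷ d ∷ K)) (λ ()) = refl

zeta-sumLin : ∀ {ℓ} (x : Lin ℓ) → zeta x ≡ sumLin (λ q K → q * zetaB K) x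
zeta-sumLin [] = refl
zeta-sumLin ((q , K) ∷ x) = cong (q * zetaB K +_) (zeta-sumLin x)

zeta-split : ∀ {ℓ} (v : Col ℓ) (x : Lin ℓ) → zeta x ≡ coeff x [] + coeff x (v ∷ []) + sumWhere (otherSingleton v) x
zeta-split v x = begin
  zeta x ≡⟨ zeta-sumLin x ⟩
  sumLin (λ q K → q * zetaB K) x
    ≡⟨ sum-cong _ _ (λ { (q , K) → trans (cong (q *_) (zetaB-split v K))
          (trans (QP.*-distribˡ-+ q _ _) (cong (_+ q * indicator (otherSingleton v K)) (QP.*-distribˡ-+ q _ _))) }) x ⟩
  sumLin (λ q K → q * indicator (does ([] ≟VC K)) + q * indicator (does ((v ∷ []) ≟VC K)) + q * indicator (otherSingleton v K)) x
    ≡⟨ sum-+ _ _ x ⟩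
  sumLin (λ q K → q * indicator (does ([] ≟VC K)) + q * indicator (does ((v ∷ []) ≟VC K))) x + sumWhere (otherSingleton v) x
    ≡⟨ cong (_+ sumWhere (otherSingleton v) x) (trans (sum-+ _ _ x) (cong₂ _+_ (sumLin-coeff x []) (sumLin-coeff x (v ∷ [])))) ⟩
  coeff x [] + coeff x (v ∷ []) + sumWhere (otherSingleton v) x ∎
  where open ≡-Reasoning

-- the coefficient of M_(c) in Θ(M_I) forced by gradedness and ζ_Q ∘ Θ = ν_Q
forcedCoeff1 : ∀ {ℓ} → VC ℓ → Col ℓ → ℚ
forcedCoeff1 [] c = 0ℚ
forcedCoeff1 I@(_ ∷ _) c = if does (c ≟col vsum I) then nuB I else 0ℚ

-- the coefficient of M_J in Θ(M_I) forced by the axioms, by recursion on J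
forcedCoeff : ∀ {ℓ} → VC ℓ → VC ℓ → ℚ
forcedCoeff I [] = epsB I
forcedCoeff I (c ∷ J) = sumℚ (map (λ { (P , Q) → forcedCoeff1 P c * forcedCoeff Q J }) (splits I))

sum-splits : ∀ {ℓ} (f : VC ℓ × VC ℓ → ℚ) I →
  sumℚ (map f (splits I)) ≡ sumℚ (map (λ k → f (take k I , drop k I)) (upTo (suc (length I))))
sum-splits f I = sum-map f (λ k → take k I , drop k I) (upTo (suc (length I)))

module ThetaDetermined {ℓ} (Θ : VC ℓ → Lin ℓ) (T : IsTheta Θ) where
  open IsTheta T

  -- by gradedness, the only single column that can occur in Θ(M_I) is Σ I
  coeff-Θ-otherColumn : ∀ I → IsVComp I → ∀ d → d ≢ vsum I → coeff (Θ I) (d ∷ []) ≡ 0ℚ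
  coeff-Θ-otherColumn I vi d dv with coeff (Θ I) (d ∷ []) QP.≟ 0ℚ
  ... | yes e = e
  ... | no ne = ⊥-elim (dv (trans (sym (vsum-single d)) (graded I (d ∷ []) vi ne)))

  coeff-Θ-single : ∀ I → IsVComp I → ∀ c → coeff (Θ I) (c ∷ []) ≡ forcedCoeff1 I c
  coeff-Θ-single [] vi c with c ≟col vzero
  ... | no ne = coeff-Θ-otherColumn [] vi c ne
  ... | yes refl = supported [] (vzero ∷ []) vi zeroColumn
    where
    zeroColumn : ¬ IsVComp (vzero {ℓ} ∷ [])
    zeroColumn (p ∷ []) rewrite wt-vzero {ℓ} = NP.<-irrefl refl p
  coeff-Θ-single I@(_ ∷ _) vi c with c ≟col vsum I
  ... | no ne = coeff-Θ-otherColumn I vi c ne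
  ... | yes refl = begin
      coeff (Θ I) (v ∷ [])  ≡⟨ sym (QP.+-identityˡ _) ⟩
      0ℚ + coeff (Θ I) (v ∷ [])  ≡⟨ cong (_+ coeff (Θ I) (v ∷ [])) (sym (counit I vi)) ⟩
      coeff (Θ I) [] + coeff (Θ I) (v ∷ [])  ≡⟨ sym (QP.+-identityʳ _) ⟩
      coeff (Θ I) [] + coeff (Θ I) (v ∷ []) + 0ℚ  ≡⟨ cong (coeff (Θ I) [] + coeff (Θ I) (v ∷ []) +_) (sym others) ⟩
      coeff (Θ I) [] + coeff (Θ I) (v ∷ []) + sumWhere (otherSingleton v) (Θ I)  ≡⟨ sym (zeta-split v (Θ I)) ⟩
      zeta (Θ I) ≡⟨ zetaCond I vi ⟩
      nuB I ∎
    where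
    open ≡-Reasoning
    v = vsum I
    others : sumWhere (otherSingleton v) (Θ I) ≡ 0ℚ
    others = sumWhere-vanishes (Θ I) (otherSingleton v) vanish
      where
      false≢true : false ≢ true
      false≢true ()
      vanish : ∀ K → otherSingleton v K ≡ true → coeff (Θ I) K ≡ 0ℚ
      vanish [] ()
      vanish (_ ∷ _ ∷ _) ()
      vanish (d ∷ []) p = coeff-Θ-otherColumn I vi d (λ { refl → false≢true (trans (sym (otherSingleton-self v)) p) })

  -- comultiplicativity at M_(c) ⊗ M_J, by induction on J
  coeff-Θ-forced : ∀ I J → IsVComp I → coeff (Θ I) J ≡ forcedCoeff I J
  coeff-Θ-forced I [] vi = counit I vi
  coeff-Θ-forced I (c ∷ J) vi = begin
    coeff (Θ I) (c ∷ J)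
      ≡⟨ comult I (c ∷ []) J vi ⟩
    sumℚ (map (λ { (P , Q) → coeff (Θ P) (c ∷ []) * coeff (Θ Q) J }) (splits I))
      ≡⟨ sum-splits (λ { (P , Q) → coeff (Θ P) (c ∷ []) * coeff (Θ Q) J }) I ⟩
    sumℚ (map (λ k → coeff (Θ (take k I)) (c ∷ []) * coeff (Θ (drop k I)) J) (upTo (suc (length I))))
      ≡⟨ sum-cong _ _ (λ k → cong₂ _*_ (coeff-Θ-single (take k I) (AllP.take⁺ k vi) c)
                                        (coeff-Θ-forced (drop k I) J (AllP.drop⁺ k vi))) (upTo (suc (length I))) ⟩
    sumℚ (map (λ k → forcedCoeff1 (take k I) c * forcedCoeff (drop k I) J) (upTo (suc (length I))))
      ≡⟨ sym (sum-splits (λ { (P , Q) → forcedCoeff1 P c * forcedCoeff Q J }) I) ⟩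
    forcedCoeff I (c ∷ J) ∎
    where open ≡-Reasoning

-- Step 2: ζ̄_Q ∘ S and the character ν_Q

isOdd-suc : ∀ n → isOdd (suc n) ≡ not (isOdd n)
isOdd-suc zero = refl
isOdd-suc (suc n) = trans isOdd-ss (sym (trans (cong not (isOdd-suc n)) (not-involutive (isOdd n))))
  where isOdd-ss : isOdd (suc (suc n)) ≡ isOdd n
        isOdd-ss = cong (λ z → not (z ℕ.≡ᵇ 0)) (trans (cong (ℕ._% 2) (NP.+-comm 2 n)) ([m+n]%n≡m%n n 2))

sign-suc : ∀ n → sign (suc n) ≡ - sign n
sign-suc n rewrite isOdd-suc n with isOdd n
... | true = refl
... | false = refl

sign-+ : ∀ m n → sign (m ℕ.+ n) ≡ sign m * sign n
sign-+ zero n = sym (QP.*-identityˡ (sign n))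
sign-+ (suc m) n rewrite sign-suc (m ℕ.+ n) | sign-suc m | sign-+ m n = QP.neg-distribˡ-* (sign m) (sign n)

sign-split : ∀ x r l → sign (suc l ℕ.+ (x ℕ.+ r)) ≡ - 1ℚ * (sign x * sign (l ℕ.+ r))
sign-split x r l = begin
  sign (suc l ℕ.+ (x ℕ.+ r)) ≡⟨ sign-suc (l ℕ.+ (x ℕ.+ r)) ⟩
  - sign (l ℕ.+ (x ℕ.+ r)) ≡⟨ cong (λ z → - z) (trans (sign-+ l (x ℕ.+ r)) (cong (sign l *_) (sign-+ x r))) ⟩
  - (sign l * (sign x * sign r))
    ≡⟨ S.solve 3 (λ a b c → S.:- (a S.:* (b S.:* c)) S.:= S.con (- 1ℚ) S.:* (b S.:* (a S.:* c))) refl (sign l) (sign x) (sign r) ⟩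
  - 1ℚ * (sign x * (sign l * sign r)) ≡⟨ cong (λ z → - 1ℚ * (sign x * z)) (sym (sign-+ l r)) ⟩
  - 1ℚ * (sign x * sign (l ℕ.+ r)) ∎
  where open ≡-Reasoning

zetaBarB : ∀ {ℓ} → VC ℓ → ℚ
zetaBarB K = sign (totwt K) * zetaB K

zetaBarB-single : ∀ {ℓ} (a : Col ℓ) → zetaBarB (a ∷ []) ≡ sign (wt a)
zetaBarB-single a = trans (cong (λ n → sign n * 1ℚ) (NP.+-identityʳ (wt a))) (QP.*-identityʳ (sign (wt a)))

zetaBarB-long : ∀ {ℓ} (x y : Col ℓ) K → zetaBarB (x ∷ y ∷ K) ≡ 0ℚ
zetaBarB-long x y K = QP.*-zeroʳ (sign (totwt (x ∷ y ∷ K)))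

zetaBar-++ : ∀ {ℓ} (x y : Lin ℓ) → zetaBar (x ++ y) ≡ zetaBar x + zetaBar y
zetaBar-++ x y = sum-++ _ x y

zetaBar-concatMap : ∀ {ℓ} {A : Set} (f : A → Lin ℓ) xs → zetaBar (concatMap f xs) ≡ sumℚ (map (zetaBar ∘ f) xs)
zetaBar-concatMap f = sum-concatMap _ f (zetaBar ∘ f) (λ _ → refl)

zetaBar-scale : ∀ {ℓ} q (x : Lin ℓ) → zetaBar (scale q x) ≡ q * zetaBar x
zetaBar-scale q [] = sym (QP.*-zeroʳ q)
zetaBar-scale q ((r , K) ∷ x) = trans (cong (q * r * zetaBarB K +_) (zetaBar-scale q x)) (
  S.solve 4 (λ q r z s → q S.:* r S.:* z S.:+ q S.:* s S.:= q S.:* (r S.:* z S.:+ s)) refl q r (zetaBarB K) (zetaBar x))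

zetaBar-const : ∀ {ℓ} q (L : List (VC ℓ)) → zetaBar (map (λ K → (q , K)) L) ≡ q * sumℚ (map zetaBarB L)
zetaBar-const q L = trans (sum-map _ _ L) (sum-scale q zetaBarB L)

-- Prepending a column to a nonempty composition kills ζ̄_Q; hence the
-- quasi-shuffles of I and J contribute nothing after a column x unless I = J = ().
module _ {ℓ} (x : Col ℓ) where

  private
    f : VC ℓ → ℚ
    f K = zetaBarB (x ∷ K)

  zetaBarB-cons-consed : ∀ y (L : List (VC ℓ)) → sumℚ (map f (map (y ∷_) L)) ≡ 0ℚ
  zetaBarB-cons-consed y L = trans (sum-map _ _ L) (sum-zero _ (zetaBarB-long x y) L)

  zetaBarB-cons-qsh-cons : ∀ a b I J → sumℚ (map f (qsh (a ∷ I) (b ∷ J))) ≡ 0ℚ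
  zetaBarB-cons-qsh-cons a b I J =
    trans (sum-++ f (map (a ∷_) (qsh I (b ∷ J))) (map (b ∷_) (qsh (a ∷ I) J) ++ map (vadd a b ∷_) (qsh I J)))
    (cong₂ _+_ (zetaBarB-cons-consed a (qsh I (b ∷ J)))
      (trans (sum-++ f (map (b ∷_) (qsh (a ∷ I) J)) (map (vadd a b ∷_) (qsh I J)))
             (cong₂ _+_ (zetaBarB-cons-consed b (qsh (a ∷ I) J)) (zetaBarB-cons-consed (vadd a b) (qsh I J)))))

  zetaBarB-cons-qshʳ : ∀ I b J → sumℚ (map f (qsh I (b ∷ J))) ≡ 0ℚ
  zetaBarB-cons-qshʳ [] b J = cong (_+ 0ℚ) (zetaBarB-long x b J)
  zetaBarB-cons-qshʳ (a ∷ I) b J = zetaBarB-cons-qsh-cons a b I J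

  zetaBarB-cons-qshˡ : ∀ a I J → sumℚ (map f (qsh (a ∷ I) J)) ≡ 0ℚ
  zetaBarB-cons-qshˡ a I [] = cong (_+ 0ℚ) (zetaBarB-long x a I)
  zetaBarB-cons-qshˡ a I (b ∷ J) = zetaBarB-cons-qsh-cons a b I J

zetaBarB-qsh : ∀ {ℓ} (I J : VC ℓ) → sumℚ (map zetaBarB (qsh I J)) ≡ zetaBarB I * zetaBarB J
zetaBarB-qsh [] J = trans (QP.+-identityʳ (zetaBarB J)) (sym (QP.*-identityˡ (zetaBarB J)))
zetaBarB-qsh (a ∷ I) [] = trans (QP.+-identityʳ (zetaBarB (a ∷ I))) (sym (QP.*-identityʳ (zetaBarB (a ∷ I))))
zetaBarB-qsh (a ∷ I) (b ∷ J) = begin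
  sumℚ (map zetaBarB (map (a ∷_) (qsh I (b ∷ J)) ++ (map (b ∷_) (qsh (a ∷ I) J) ++ map (vadd a b ∷_) (qsh I J))))
    ≡⟨ trans (sum-++ zetaBarB (map (a ∷_) (qsh I (b ∷ J))) _) (cong (sumℚ (map zetaBarB (map (a ∷_) (qsh I (b ∷ J)))) +_)
         (sum-++ zetaBarB (map (b ∷_) (qsh (a ∷ I) J)) (map (vadd a b ∷_) (qsh I J)))) ⟩
  sumℚ (map zetaBarB (map (a ∷_) (qsh I (b ∷ J)))) + (sumℚ (map zetaBarB (map (b ∷_) (qsh (a ∷ I) J)))
    + sumℚ (map zetaBarB (map (vadd a b ∷_) (qsh I J))))
    ≡⟨ cong₂ _+_ (trans (sum-map zetaBarB (a ∷_) (qsh I (b ∷ J))) (zetaBarB-cons-qshʳ a I b J))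
         (cong₂ _+_ (trans (sum-map zetaBarB (b ∷_) (qsh (a ∷ I) J)) (zetaBarB-cons-qshˡ b a I J))
                    (sum-map zetaBarB (vadd a b ∷_) (qsh I J))) ⟩
  0ℚ + (0ℚ + sumℚ (map (λ K → zetaBarB (vadd a b ∷ K)) (qsh I J)))
    ≡⟨ trans (QP.+-identityˡ _) (trans (QP.+-identityˡ _) (merged I J)) ⟩
  zetaBarB (a ∷ I) * zetaBarB (b ∷ J) ∎
  where
  open ≡-Reasoning
  -- only I = J = () survives after the merged column a + b
  merged : ∀ I J → sumℚ (map (λ K → zetaBarB (vadd a b ∷ K)) (qsh I J)) ≡ zetaBarB (a ∷ I) * zetaBarB (b ∷ J)
  merged [] [] = trans (QP.+-identityʳ _) (trans (zetaBarB-single (vadd a b))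
    (trans (trans (cong sign (wt-vadd a b)) (sign-+ (wt a) (wt b))) (sym (cong₂ _*_ (zetaBarB-single a) (zetaBarB-single b)))))
  merged [] (b' ∷ J') = trans (zetaBarB-cons-qshʳ (vadd a b) [] b' J')
    (sym (trans (cong (zetaBarB (a ∷ []) *_) (zetaBarB-long b b' J')) (QP.*-zeroʳ (zetaBarB (a ∷ [])))))
  merged (a' ∷ I') J' = trans (zetaBarB-cons-qshˡ (vadd a b) a' I' J')
    (sym (trans (cong (_* zetaBarB (b ∷ J')) (zetaBarB-long a a' I')) (QP.*-zeroˡ (zetaBarB (b ∷ J')))))

zetaBar-mul-M : ∀ {ℓ} (P : VC ℓ) z → zetaBar (mul (M P) z) ≡ zetaBarB P * zetaBar z
zetaBar-mul-M P z = trans (zetaBar-++ (concatMap _ z) []) (trans (QP.+-identityʳ _) (go z))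
  where
  go : ∀ z → zetaBar (concatMap (λ { (r , J) → map (λ K → (1ℚ * r , K)) (qsh P J) }) z) ≡ zetaBarB P * zetaBar z
  go [] = sym (QP.*-zeroʳ (zetaBarB P))
  go ((r , J) ∷ z) = begin
    zetaBar (map (λ K → (1ℚ * r , K)) (qsh P J) ++ _)
      ≡⟨ zetaBar-++ (map (λ K → (1ℚ * r , K)) (qsh P J)) _ ⟩
    zetaBar (map (λ K → (1ℚ * r , K)) (qsh P J)) + _
      ≡⟨ cong₂ _+_ (trans (zetaBar-const (1ℚ * r) (qsh P J)) (cong₂ _*_ (QP.*-identityˡ r) (zetaBarB-qsh P J))) (go z) ⟩
    r * (zetaBarB P * zetaBarB J) + zetaBarB P * zetaBar z
      ≡⟨ S.solve 4 (λ r p j z → r S.:* (p S.:* j) S.:+ p S.:* z S.:= p S.:* (r S.:* j S.:+ z)) refl r (zetaBarB P) (zetaBarB J) (zetaBar z) ⟩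
    zetaBarB P * zetaBar ((r , J) ∷ z) ∎
    where open ≡-Reasoning

-- In the recursion for S(M_{x r}) only the split after the first column survives ζ̄_Q.
zetaBar-antipode-tail : ∀ {ℓ} f (x : Col ℓ) r →
  sumℚ (map (λ k → zetaBar (mul (M (take (suc k) (x ∷ r))) (antipodeF f (drop (suc k) (x ∷ r))))) (applyUpTo suc (length r))) ≡ 0ℚ
zetaBar-antipode-tail f x [] = refl
zetaBar-antipode-tail f x (y ∷ r') = trans (sum-applyUpTo term suc (length (y ∷ r')))
  (Σn-zero (term ∘ suc) (λ j → trans (zetaBar-mul-M (x ∷ y ∷ take j r') (antipodeF f (drop j r')))
    (trans (cong (_* zetaBar (antipodeF f (drop j r'))) (zetaBarB-long x y (take j r'))) (QP.*-zeroˡ (zetaBar (antipodeF f (drop j r')))))) (length (y ∷ r')))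
  where term = λ k → zetaBar (mul (M (take (suc k) (x ∷ y ∷ r'))) (antipodeF f (drop (suc k) (x ∷ y ∷ r'))))

zetaBar-antipodeF : ∀ {ℓ} f (I : VC ℓ) → length I ℕ.≤ f → zetaBar (antipodeF f I) ≡ sign (length I ℕ.+ totwt I)
zetaBar-antipodeF zero [] _ = refl
zetaBar-antipodeF (suc f) [] _ = refl
zetaBar-antipodeF (suc f) I@(x ∷ r) (ℕ.s≤s le) = begin
  zetaBar (antipodeF (suc f) I)
    ≡⟨ zetaBar-scale (- 1ℚ) (concatMap h L) ⟩
  - 1ℚ * zetaBar (concatMap h L)
    ≡⟨ cong (- 1ℚ *_) (zetaBar-concatMap h L) ⟩
  - 1ℚ * (zetaBar (h 1) + sumℚ (map (zetaBar ∘ h) (map suc (applyUpTo suc (length r)))))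
    ≡⟨ cong (λ z → - 1ℚ * (zetaBar (h 1) + z)) rest ⟩
  - 1ℚ * (zetaBar (h 1) + 0ℚ)
    ≡⟨ cong (- 1ℚ *_) (trans (QP.+-identityʳ _) (trans (zetaBar-mul-M (x ∷ []) (antipodeF f r))
         (cong₂ _*_ (zetaBarB-single x) (zetaBar-antipodeF f r le)))) ⟩
  - 1ℚ * (sign (wt x) * sign (length r ℕ.+ totwt r))
    ≡⟨ sym (sign-split (wt x) (totwt r) (length r)) ⟩
  sign (length I ℕ.+ totwt I) ∎
  where
  open ≡-Reasoning
  h : ℕ → Lin _
  h k = mul (M (take k I)) (antipodeF f (drop k I))
  L = map suc (upTo (length I))
  rest : sumℚ (map (zetaBar ∘ h) (map suc (applyUpTo suc (length r)))) ≡ 0ℚ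
  rest = trans (sum-map (zetaBar ∘ h) suc (applyUpTo suc (length r))) (zetaBar-antipode-tail f x r)

two : ℚ
two = 1ℚ + 1ℚ

nuSplit : ∀ {ℓ} → VC ℓ → ℚ
nuSplit I = Σn (λ k → sign (length (take k I) ℕ.+ totwt (take k I)) * zetaB (drop k I)) (suc (length I))

nuB-split : ∀ {ℓ} (I : VC ℓ) → nuB I ≡ nuSplit I
nuB-split I = begin
  nuB I
    ≡⟨ sum-splits (λ { (P , Q) → zetaBar (antipode P) * zetaB Q }) I ⟩
  sumℚ (map (λ k → zetaBar (antipode (take k I)) * zetaB (drop k I)) (upTo (suc (length I))))
    ≡⟨ sum-applyUpTo (λ k → zetaBar (antipode (take k I)) * zetaB (drop k I)) (λ k → k) (suc (length I)) ⟩
  Σn (λ k → zetaBar (antipode (take k I)) * zetaB (drop k I)) (suc (length I))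
    ≡⟨ Σn-cong _ _ (λ k → cong (_* zetaB (drop k I)) (zetaBar-antipodeF (length (take k I)) (take k I) NP.≤-refl)) (suc (length I)) ⟩
  nuSplit I ∎
  where open ≡-Reasoning

nuSplit-cons : ∀ {ℓ} (x : Col ℓ) r → nuSplit (x ∷ r) ≡ zetaB (x ∷ r) + (- 1ℚ * sign (wt x)) * nuSplit r
nuSplit-cons x r = cong₂ _+_ (QP.*-identityˡ (zetaB (x ∷ r)))
  (trans (Σn-cong _ (λ k → (- 1ℚ * sign (wt x)) * term k) shift (suc (length r)))
         (Σn-scale (- 1ℚ * sign (wt x)) term (suc (length r))))
  where
  term = λ k → sign (length (take k r) ℕ.+ totwt (take k r)) * zetaB (drop k r)
  shift : ∀ k → sign (length (take (suc k) (x ∷ r)) ℕ.+ totwt (take (suc k) (x ∷ r))) * zetaB (drop (suc k) (x ∷ r))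
                ≡ (- 1ℚ * sign (wt x)) * term k
  shift k = trans (cong (_* zetaB (drop k r)) (sign-split (wt x) (totwt (take k r)) (length (take k r))))
    (S.solve 3 (λ a b z → S.con (- 1ℚ) S.:* (a S.:* b) S.:* z S.:= S.con (- 1ℚ) S.:* a S.:* (b S.:* z)) refl
       (sign (wt x)) (sign (length (take k r) ℕ.+ totwt (take k r))) (zetaB (drop k r)))

nuClosed : ∀ {ℓ} → VC ℓ → ℚ
nuClosed [] = 1ℚ
nuClosed I@(_ ∷ _) = if lastOdd I then two * sign (length I ℕ.+ totwt I) else 0ℚ

nuSplit-closed : ∀ {ℓ} (I : VC ℓ) → nuSplit I ≡ nuClosed I
nuSplit-closed [] = refl
nuSplit-closed {ℓ} (x ∷ []) = trans (nuSplit-cons x []) (trans (cong (λ z → 1ℚ + - 1ℚ * sign (wt x) * z) (nuSplit-closed {ℓ} [])) closedStep)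
  where
  closedStep : 1ℚ + - 1ℚ * sign (wt x) * 1ℚ ≡ nuClosed (x ∷ [])
  closedStep rewrite NP.+-identityʳ (wt x) | sign-suc (wt x) with isOdd (wt x)
  ... | true = refl
  ... | false = refl
nuSplit-closed (x ∷ y ∷ r) = trans (nuSplit-cons x (y ∷ r)) (trans (cong (λ z → 0ℚ + - 1ℚ * sign (wt x) * z) (nuSplit-closed (y ∷ r))) closedStep)
  where
  L = length (y ∷ r)
  Tw = totwt (y ∷ r)
  closedStep : 0ℚ + - 1ℚ * sign (wt x) * nuClosed (y ∷ r) ≡ nuClosed (x ∷ y ∷ r)
  closedStep with lastOdd (y ∷ r)
  ... | true = trans (S.solve 2 (λ a b → S.con 0ℚ S.:+ S.con (- 1ℚ) S.:* a S.:* (S.con two S.:* b) S.:= S.con two S.:* (S.con (- 1ℚ) S.:* (a S.:* b))) refl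
      (sign (wt x)) (sign (L ℕ.+ Tw)))
                     (cong (two *_) (sym (sign-split (wt x) Tw L)))
  ... | false = trans (QP.+-identityˡ _) (QP.*-zeroʳ (- 1ℚ * sign (wt x)))

nuB-closed : ∀ {ℓ} (I : VC ℓ) → nuB I ≡ nuClosed I
nuB-closed I = trans (nuB-split I) (nuSplit-closed I)

-- Step 3: the claimed Θ(M_I) satisfies the same recursion

coarseningCount : ∀ {ℓ} → VC ℓ → VC ℓ → ℚ
coarseningCount K J = sumℚ (map (λ J' → indicator (does (J ≟VC J'))) (coarsenings K))

coeff-mapP : ∀ {ℓ} (L : List (VC ℓ)) J →
  coeff (map (λ J' → (pow2 (length J') , J')) L) J ≡ pow2 (length J) * sumℚ (map (λ J' → indicator (does (J ≟VC J'))) L)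
coeff-mapP [] J = sym (QP.*-zeroʳ (pow2 (length J)))
coeff-mapP (J' ∷ L) J with J ≟VC J'
... | yes refl = trans (cong (pow2 (length J) +_) (coeff-mapP L J))
   (trans (cong (_+ pow2 (length J) * sumℚ (map (λ J' → indicator (does (J ≟VC J'))) L)) (sym (QP.*-identityʳ (pow2 (length J)))))
          (sym (QP.*-distribˡ-+ (pow2 (length J)) 1ℚ _)))
... | no _ = trans (coeff-mapP L J) (sym (cong (pow2 (length J) *_) (QP.+-identityˡ _)))

coeff-eta : ∀ {ℓ} (K J : VC ℓ) → coeff (eta K) J ≡ pow2 (length J) * coarseningCount K J
coeff-eta K J = coeff-mapP (coarsenings K) J

-- Coarsenings of a K whose first block starts with acc: the first block of
-- J = j J' is acc + a₁ + … + a_t, and the rest is a coarsening of K_{>t}.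
firstMergeInd : ∀ {ℓ} → Col ℓ → Col ℓ → VC ℓ → VC ℓ → ℚ
firstMergeInd acc j J [] = 0ℚ
firstMergeInd acc j J (b ∷ c) = indicator (does ((j ∷ J) ≟VC (vadd acc b ∷ c)))

firstMergeCount : ∀ {ℓ} → VC ℓ → Col ℓ → Col ℓ → VC ℓ → ℚ
firstMergeCount K acc j J = sumℚ (map (firstMergeInd acc j J) (coarsenings K))

firstBlockCount : ∀ {ℓ} → VC ℓ → Col ℓ → Col ℓ → VC ℓ → ℚ
firstBlockCount [] acc j J = 0ℚ
firstBlockCount (a ∷ K) acc j J = indicator (does (j ≟col vadd acc a)) * coarseningCount K J + firstBlockCount K (vadd acc a) j J

firstMergeCount-closed : ∀ {ℓ} (K : VC ℓ) acc j J → firstMergeCount K acc j J ≡ firstBlockCount K acc j J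
firstMergeCount-closed [] acc j J = refl
firstMergeCount-closed {ℓ} (a ∷ K) acc j J = trans (sum-concatMap (firstMergeInd acc j J) _ split pointwise (coarsenings K))
  (trans (sum-+ (λ c → indicator d * indicator (does (J ≟VC c))) (firstMergeInd (vadd acc a) j J) (coarsenings K))
     (cong₂ _+_ (sum-scale (indicator d) (λ c → indicator (does (J ≟VC c))) (coarsenings K)) (firstMergeCount-closed K (vadd acc a) j J)))
  where
  d = does (j ≟col vadd acc a)
  split : VC ℓ → ℚ
  split c = indicator d * indicator (does (J ≟VC c)) + firstMergeInd (vadd acc a) j J c
  pointwise : (c : VC ℓ) → _
  pointwise [] = cong (_+ 0ℚ) (indicator-∧ d (does (J ≟VC [])))
  pointwise (b ∷ c) = cong₂ _+_ (indicator-∧ d (does (J ≟VC (b ∷ c))))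
                  (trans (QP.+-identityʳ _) (cong (λ z → indicator (does ((j ∷ J) ≟VC (z ∷ c)))) (sym (vadd-assoc acc a b))))

coarseningCount-cons : ∀ {ℓ} (K : VC ℓ) j J → coarseningCount K (j ∷ J) ≡ firstBlockCount K vzero j J
coarseningCount-cons K j J = trans (sum-cong _ (firstMergeInd vzero j J) pt (coarsenings K)) (firstMergeCount-closed K vzero j J)
  where
  pt : ∀ c → indicator (does ((j ∷ J) ≟VC c)) ≡ firstMergeInd vzero j J c
  pt [] = refl
  pt (b ∷ c) = cong (λ z → indicator (does ((j ∷ J) ≟VC (z ∷ c)))) (sym (vadd-zeroˡ b))

coarseningCount-nil : ∀ {ℓ} (a : Col ℓ) K → coarseningCount (a ∷ K) [] ≡ 0ℚ
coarseningCount-nil a K = trans (sum-concatMap (λ J' → indicator (does ([] ≟VC J'))) _ (λ _ → 0ℚ) pt (coarsenings K)) (sum-zero (λ _ → 0ℚ) (λ _ → refl)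
    (coarsenings K))
  where
  pt : (c : VC _) → _
  pt [] = refl
  pt (b ∷ c) = refl

addHead : ∀ {ℓ} → Col ℓ → VC ℓ → VC ℓ
addHead acc [] = []
addHead acc (y ∷ L) = vadd acc y ∷ L

addHead-addHead : ∀ {ℓ} (a b : Col ℓ) L → addHead a (addHead b L) ≡ addHead (vadd a b) L
addHead-addHead a b [] = refl
addHead-addHead a b (y ∷ L) = cong (_∷ L) (sym (vadd-assoc a b y))

oddGo-acc : ∀ {ℓ} (acc : Col ℓ) I → oddGo acc I ≡ addHead acc (oddGo vzero I)
oddGo-acc acc [] = refl
oddGo-acc acc (x ∷ r) with isOdd (wt x)
... | true = cong (_∷ oddGo vzero r) (cong (vadd acc) (sym (vadd-zeroˡ x)))
... | false = trans (oddGo-acc (vadd acc x) r) (trans (cong (λ z → addHead z (oddGo vzero r)) (cong (vadd acc) (sym (vadd-zeroˡ x))))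
                (trans (sym (addHead-addHead acc (vadd vzero x) (oddGo vzero r))) (cong (addHead acc) (sym (oddGo-acc (vadd vzero x) r)))))

firstBlockCount-addHead : ∀ {ℓ} (x : Col ℓ) L acc j J → firstBlockCount (addHead x L) acc j J ≡ firstBlockCount L (vadd acc x) j J
firstBlockCount-addHead x [] acc j J = refl
firstBlockCount-addHead x (b ∷ L) acc j J rewrite sym (vadd-assoc acc x b) = refl

oddPart-nonempty : ∀ {ℓ} (acc : Col ℓ) I → lastOdd I ≡ true → oddGo acc I ≢ []
oddPart-nonempty acc [] () e
oddPart-nonempty acc (x ∷ []) isLastOdd e = ne (subst (λ b → (if b then vadd acc x ∷ [] else []) ≡ []) isLastOdd e)
  where ne : _ ∷ [] ≢ []
        ne ()
oddPart-nonempty acc (x ∷ y ∷ r) isLastOdd e = oddPart-nonempty (vadd acc x) (y ∷ r) isLastOdd (rest-empty (isOdd (wt x)) e)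
  where rest-empty : ∀ b → (if b then vadd acc x ∷ oddGo vzero (y ∷ r) else oddGo (vadd acc x) (y ∷ r)) ≡ [] →
                     oddGo (vadd acc x) (y ∷ r) ≡ []
        rest-empty false e = e

-- Σ_t [c = acc + Σ I_{≤t}] [last column of I_{≤t} odd] #(J among coarsenings of odd(I_{>t})):
-- the sum produced by the recursion; it counts c J among the coarsenings of odd(I)
oddSplitSum : ∀ {ℓ} → Col ℓ → VC ℓ → Col ℓ → VC ℓ → ℚ
oddSplitSum acc I c J = Σn (λ k → indicator (does (c ≟col vadd acc (vsum (take (suc k) I)))) * indicator (lastOdd (take (suc k) I)) * coarseningCount
    (oddPart (drop (suc k) I)) J) (length I)

oddSplitSum-closed : ∀ {ℓ} (acc : Col ℓ) I c J → lastOdd I ≡ true → oddSplitSum acc I c J ≡ firstBlockCount (oddPart I) acc c J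
oddSplitSum-closed acc [] c J ()
oddSplitSum-closed acc (x ∷ []) c J isLastOdd = firstColumn (isOdd (wt x)) isLastOdd
  where
  firstColumn : ∀ b → b ≡ true → indicator (does (c ≟col vadd acc (vadd x vzero))) * indicator b * coarseningCount [] J + 0ℚ ≡
                firstBlockCount (if b then vadd vzero x ∷ [] else []) acc c J
  firstColumn true _ rewrite vadd-zeroʳ x | vadd-zeroˡ x = cong (_+ 0ℚ) (cong (_* coarseningCount [] J) (QP.*-identityʳ (indicator (does (c ≟col vadd acc x)))))
oddSplitSum-closed acc (x ∷ y ∷ r) c J isLastOdd =
  trans (cong (f0 +_) (trans (Σn-cong _ _ pt (length (y ∷ r))) (oddSplitSum-closed (vadd acc x) (y ∷ r) c J isLastOdd)))
        (firstColumn (isOdd (wt x)))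
  where
  f0 = indicator (does (c ≟col vadd acc (vadd x vzero))) * indicator (isOdd (wt x)) * coarseningCount (oddPart (y ∷ r)) J
  pt : ∀ k → indicator (does (c ≟col vadd acc (vadd x (vsum (take (suc k) (y ∷ r)))))) * indicator (lastOdd (take (suc k) (y ∷ r))) * coarseningCount (oddPart
      (drop (suc k) (y ∷ r))) J
           ≡ indicator (does (c ≟col vadd (vadd acc x) (vsum (take (suc k) (y ∷ r))))) * indicator (lastOdd (take (suc k) (y ∷ r))) * coarseningCount (oddPart
               (drop (suc k) (y ∷ r))) J
  pt k rewrite vadd-assoc acc x (vsum (take (suc k) (y ∷ r))) = refl
  firstColumn : ∀ b → indicator (does (c ≟col vadd acc (vadd x vzero))) * indicator b * coarseningCount (oddPart (y ∷ r)) J + firstBlockCount (oddPart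
      (y ∷ r)) (vadd acc x) c J ≡
                firstBlockCount (if b then vadd vzero x ∷ oddGo vzero (y ∷ r) else oddGo (vadd vzero x) (y ∷ r)) acc c J
  firstColumn true rewrite vadd-zeroʳ x | vadd-zeroˡ x = cong (_+ firstBlockCount (oddPart (y ∷ r)) (vadd acc x) c J) (cong (_* coarseningCount (oddPart (y ∷ r)) J)
      (QP.*-identityʳ (indicator (does (c ≟col vadd acc x)))))
  firstColumn false = trans (cong (_+ firstBlockCount (oddPart (y ∷ r)) (vadd acc x) c J)
      (trans (cong (_* coarseningCount (oddPart (y ∷ r)) J) (QP.*-zeroʳ (indicator (does (c ≟col vadd acc (vadd x vzero))))))
      (QP.*-zeroˡ (coarseningCount (oddPart (y ∷ r)) J))))
    (trans (QP.+-identityˡ _) (sym (trans (cong (λ L → firstBlockCount L acc c J) (oddGo-acc (vadd vzero x) (y ∷ r)))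
       (trans (firstBlockCount-addHead (vadd vzero x) (oddPart (y ∷ r)) acc c J)
           (cong (λ z → firstBlockCount (oddPart (y ∷ r)) (vadd acc z) c J) (vadd-zeroˡ x))))))

thetaMCoeff : ∀ {ℓ} → VC ℓ → VC ℓ → ℚ
thetaMCoeff [] J = indicator (does (J ≟VC []))
thetaMCoeff I@(_ ∷ _) J = if lastOdd I then sign (length I ℕ.+ totwt I) * (pow2 (length J) * coarseningCount (oddPart I) J) else 0ℚ

coeff-thetaM : ∀ {ℓ} (I J : VC ℓ) → coeff (thetaM I) J ≡ thetaMCoeff I J
coeff-thetaM [] J = coeff-M [] J
coeff-thetaM (x ∷ r) J with lastOdd (x ∷ r)
... | true = trans (coeff-scale (sign (length (x ∷ r) ℕ.+ totwt (x ∷ r))) (eta (oddPart (x ∷ r))) J) (cong (sign (length (x ∷ r) ℕ.+ totwt (x ∷ r)) *_)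
    (coeff-eta (oddPart (x ∷ r)) J))
... | false = refl

length-take-drop : ∀ {A : Set} k (I : List A) → length (take k I) ℕ.+ length (drop k I) ≡ length I
length-take-drop zero I = refl
length-take-drop (suc k) [] = refl
length-take-drop (suc k) (x ∷ I) = cong suc (length-take-drop k I)

totwt-take-drop : ∀ {ℓ} k (I : VC ℓ) → totwt (take k I) ℕ.+ totwt (drop k I) ≡ totwt I
totwt-take-drop zero I = refl
totwt-take-drop (suc k) [] = refl
totwt-take-drop (suc k) (x ∷ I) = trans (NP.+-assoc (wt x) (totwt (take k I)) (totwt (drop k I))) (cong (wt x ℕ.+_) (totwt-take-drop k I))

sign-td : ∀ {ℓ} k (I : VC ℓ) → sign (length (take k I) ℕ.+ totwt (take k I)) * sign (length (drop k I) ℕ.+ totwt (drop k I)) ≡ sign (length I ℕ.+ totwt I)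
sign-td k I = begin
  sign (a ℕ.+ b) * sign (c ℕ.+ d) ≡⟨ cong₂ _*_ (sign-+ a b) (sign-+ c d) ⟩
  sign a * sign b * (sign c * sign d) ≡⟨ S.solve 4 (λ a b c d → a S.:* b S.:* (c S.:* d) S.:= a S.:* c S.:*
      (b S.:* d)) refl (sign a) (sign b) (sign c) (sign d) ⟩
  sign a * sign c * (sign b * sign d) ≡⟨ sym (cong₂ _*_ (sign-+ a c) (sign-+ b d)) ⟩
  sign (a ℕ.+ c) * sign (b ℕ.+ d) ≡⟨ cong₂ (λ u v → sign u * sign v) (length-take-drop k I) (totwt-take-drop k I) ⟩
  sign (length I) * sign (totwt I) ≡⟨ sym (sign-+ (length I) (totwt I)) ⟩
  sign (length I ℕ.+ totwt I) ∎
  where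
  open ≡-Reasoning
  a = length (take k I)
  b = totwt (take k I)
  c = length (drop k I)
  d = totwt (drop k I)

lastOdd-drop : ∀ {ℓ} k (r : VC ℓ) → drop k r ≢ [] → lastOdd (drop k r) ≡ lastOdd r
lastOdd-drop zero r ne = refl
lastOdd-drop (suc k) [] ne = ⊥-elim (ne refl)
lastOdd-drop (suc k) (y ∷ []) ne = ⊥-elim (ne (LP.drop-[] k))
lastOdd-drop (suc k) (y ∷ z ∷ r') ne = lastOdd-drop k (z ∷ r') ne

take-all : ∀ {A : Set} k (r : List A) → drop k r ≡ [] → take k r ≡ r
take-all zero [] e = refl
take-all (suc k) [] e = refl
take-all (suc k) (y ∷ r) e = cong (y ∷_) (take-all k r e)

thetaMCoeff-scaled : ∀ {ℓ} (sP : ℚ) (Q : VC ℓ) J → (Q ≢ [] → lastOdd Q ≡ true) →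
  (two * sP) * thetaMCoeff Q J ≡ (two * pow2 (length J) * (sP * sign (length Q ℕ.+ totwt Q))) * coarseningCount (oddPart Q) J
thetaMCoeff-scaled sP [] [] h = S.solve 1 (λ s → S.con two S.:* s S.:* S.con 1ℚ S.:= S.con two S.:* S.con 1ℚ S.:* (s S.:* S.con 1ℚ) S.:*
    (S.con 1ℚ S.:+ S.con 0ℚ)) refl sP
thetaMCoeff-scaled sP [] (j ∷ J) h = S.solve 2 (λ s p → S.con two S.:* s S.:* S.con 0ℚ S.:= S.con two S.:* p S.:* (s S.:* S.con 1ℚ) S.:*
    (S.con 0ℚ S.:+ S.con 0ℚ)) refl sP (pow2 (length (j ∷ J)))
thetaMCoeff-scaled sP Q@(y ∷ q) J h rewrite h (λ ()) =
  S.solve 4 (λ s t p c → S.con two S.:* s S.:* (t S.:* (p S.:* c)) S.:= S.con two S.:* p S.:* (s S.:* t) S.:* c) refl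
    sP (sign (length Q ℕ.+ totwt Q)) (pow2 (length J)) (coarseningCount (oddPart Q) J)

-- The recursion forcedCoeff (x r) (c J') = Σ_k forcedCoeff1 (x r_{<k}) c · forcedCoeff (r_{≥k}) J'
-- holds for thetaMCoeff: only splittings whose first part ends with an odd column
-- contribute, all with the same sign, and they add up to the count of c J'.
module RecursionStep {ℓ} (x : Col ℓ) (r : VC ℓ) (c : Col ℓ) (J' : VC ℓ) where
  I = x ∷ r
  sI = sign (length I ℕ.+ totwt I)
  factor = two * pow2 (length J') * sI

  oddTerm : ℕ → ℚ
  oddTerm k = indicator (does (c ≟col vsum (x ∷ take k r))) * indicator (lastOdd (x ∷ take k r)) * coarseningCount (oddPart (drop k r)) J'

  splitTerm-odd : ∀ k → lastOdd I ≡ true → forcedCoeff1 (x ∷ take k r) c * thetaMCoeff (drop k r) J' ≡ factor * oddTerm k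
  splitTerm-odd k isLastOdd = begin
    forcedCoeff1 P c * thetaMCoeff Q J'
      ≡⟨ cong (_* thetaMCoeff Q J') (trans (if-indicator d (nuB P)) (cong (indicator d *_) (trans (nuB-closed P) (if-indicator (lastOdd P) (two * sP))))) ⟩
    indicator d * (indicator (lastOdd P) * (two * sP)) * thetaMCoeff Q J'
      ≡⟨ S.solve 4 (λ a b u t → a S.:* (b S.:* u) S.:* t S.:= a S.:* b S.:* (u S.:* t)) refl (indicator d) (indicator
          (lastOdd P)) (two * sP) (thetaMCoeff Q J') ⟩
    indicator d * indicator (lastOdd P) * ((two * sP) * thetaMCoeff Q J')
      ≡⟨ cong (indicator d * indicator (lastOdd P) *_) (thetaMCoeff-scaled sP Q J' oddTail) ⟩
    indicator d * indicator (lastOdd P) * ((two * pow2 (length J') * (sP * sQ)) * coarseningCount (oddPart Q) J')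
      ≡⟨ cong (λ z → indicator d * indicator (lastOdd P) * ((two * pow2 (length J') * z) * coarseningCount (oddPart Q) J')) (sign-td (suc k) I) ⟩
    indicator d * indicator (lastOdd P) * ((two * pow2 (length J') * sI) * coarseningCount (oddPart Q) J')
      ≡⟨ S.solve 4 (λ a b k n → a S.:* b S.:* (k S.:* n) S.:= k S.:* (a S.:* b S.:* n)) refl (indicator d) (indicator (lastOdd P)) factor (coarseningCount
          (oddPart Q) J') ⟩
    factor * oddTerm k ∎
    where
    open ≡-Reasoning
    P = x ∷ take k r
    Q = drop k r
    d = does (c ≟col vsum P)
    sP = sign (length P ℕ.+ totwt P)
    sQ = sign (length Q ℕ.+ totwt Q)
    oddTail : Q ≢ [] → lastOdd Q ≡ true
    oddTail ne = trans (lastOdd-drop (suc k) I ne) isLastOdd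

  splitTerm-even : ∀ k → lastOdd I ≡ false → forcedCoeff1 (x ∷ take k r) c * thetaMCoeff (drop k r) J' ≡ 0ℚ
  splitTerm-even k isEven with drop k r in eqd
  ... | [] rewrite take-all k r eqd = trans (cong (_* indicator (does (J' ≟VC []))) vanishes) (QP.*-zeroˡ (indicator (does (J' ≟VC []))))
    where
    vanishes : forcedCoeff1 I c ≡ 0ℚ
    dI = does (c ≟col vsum I)
    nuVanishes : nuB I ≡ 0ℚ
    nuVanishes = trans (nuB-closed I) (trans (if-indicator (lastOdd I) (two * sI))
        (trans (cong (λ b → indicator b * (two * sI)) isEven) (QP.*-zeroˡ (two * sI))))
    vanishes = trans (if-indicator dI (nuB I)) (trans (cong (indicator dI *_) nuVanishes) (QP.*-zeroʳ (indicator dI)))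
  ... | y ∷ q = trans (cong (forcedCoeff1 (x ∷ take k r) c *_) vanishes) (QP.*-zeroʳ (forcedCoeff1 (x ∷ take k r) c))
    where
    evenTail : lastOdd (y ∷ q) ≡ false
    evenTail = trans (sym (cong lastOdd eqd)) (trans (lastOdd-drop (suc k) I (λ e → case trans (sym eqd) e of λ ())) isEven)
    vanishes : thetaMCoeff (y ∷ q) J' ≡ 0ℚ
    vanishes rewrite evenTail = refl

  splitTerm : ℕ → ℚ
  splitTerm k = forcedCoeff1 (x ∷ take k r) c * thetaMCoeff (drop k r) J'

  recursion-holds : 0ℚ * thetaMCoeff I J' + Σn splitTerm (suc (length r)) ≡ thetaMCoeff I (c ∷ J')
  recursion-holds = byParity (lastOdd I) refl
    where
    byParity : ∀ b → lastOdd I ≡ b → 0ℚ * thetaMCoeff I J' + Σn splitTerm (suc (length r)) ≡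
            (if b then sI * (pow2 (length (c ∷ J')) * coarseningCount (oddPart I) (c ∷ J')) else 0ℚ)
    byParity true e = begin
      0ℚ * thetaMCoeff I J' + Σn splitTerm (suc (length r))
        ≡⟨ cong (0ℚ * thetaMCoeff I J' +_) (trans (Σn-cong splitTerm (λ k → factor * oddTerm k) (λ k → splitTerm-odd k e) (suc (length r)))
            (Σn-scale factor oddTerm (suc (length r)))) ⟩
      0ℚ * thetaMCoeff I J' + factor * Σn oddTerm (suc (length r))
        ≡⟨ cong (λ z → 0ℚ * thetaMCoeff I J' + factor * z) (trans (Σn-cong oddTerm _
            (λ k → cong (λ v → indicator (does (c ≟col v)) * indicator (lastOdd (x ∷ take k r)) * coarseningCount (oddPart (drop k r)) J')
            (sym (vadd-zeroˡ (vsum (x ∷ take k r))))) (suc (length r)))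
               (trans (oddSplitSum-closed vzero I c J' e) (sym (coarseningCount-cons (oddPart I) c J')))) ⟩
      0ℚ * thetaMCoeff I J' + factor * coarseningCount (oddPart I) (c ∷ J')
        ≡⟨ S.solve 4 (λ t p s n → S.con 0ℚ S.:* t S.:+ S.con two S.:* p S.:* s S.:* n S.:= s S.:* (S.con two S.:* p S.:* n)) refl (thetaMCoeff I J') (pow2
            (length J')) sI (coarseningCount (oddPart I) (c ∷ J')) ⟩
      sI * (pow2 (length (c ∷ J')) * coarseningCount (oddPart I) (c ∷ J')) ∎
      where open ≡-Reasoning
    byParity false e = trans (cong₂ _+_ (QP.*-zeroˡ (thetaMCoeff I J')) (Σn-zero splitTerm (λ k → splitTerm-even k e) (suc (length r)))) refl

coarseningCount-nil' : ∀ {ℓ} (L : VC ℓ) → L ≢ [] → coarseningCount L [] ≡ 0ℚ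
coarseningCount-nil' [] ne = ⊥-elim (ne refl)
coarseningCount-nil' (a ∷ K) ne = coarseningCount-nil a K

forcedCoeff-thetaM : ∀ {ℓ} (J I : VC ℓ) → forcedCoeff I J ≡ thetaMCoeff I J
forcedCoeff-thetaM [] [] = refl
forcedCoeff-thetaM [] I@(_ ∷ _) = counitCase (lastOdd I) refl
  where
  -- ε(Θ(M_I)) = 0 matches the absence of () among the coarsenings of odd(I)
  counitCase : ∀ b → lastOdd I ≡ b → 0ℚ ≡ (if b then sign (length I ℕ.+ totwt I) * (pow2 0 * coarseningCount (oddPart I) []) else 0ℚ)
  counitCase true e rewrite coarseningCount-nil' (oddPart I) (oddPart-nonempty vzero I e) =
    sym (trans (cong (sign (length I ℕ.+ totwt I) *_) (QP.*-zeroʳ (pow2 0))) (QP.*-zeroʳ (sign (length I ℕ.+ totwt I))))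
  counitCase false e = refl
forcedCoeff-thetaM (c ∷ J') I = begin
  forcedCoeff I (c ∷ J')
    ≡⟨ sum-splits (λ { (P , Q) → forcedCoeff1 P c * forcedCoeff Q J' }) I ⟩
  sumℚ (map (λ k → forcedCoeff1 (take k I) c * forcedCoeff (drop k I) J') (upTo (suc (length I))))
    ≡⟨ sum-applyUpTo (λ k → forcedCoeff1 (take k I) c * forcedCoeff (drop k I) J') (λ k → k) (suc (length I)) ⟩
  Σn (λ k → forcedCoeff1 (take k I) c * forcedCoeff (drop k I) J') (suc (length I))
    ≡⟨ Σn-cong _ _ (λ k → cong (forcedCoeff1 (take k I) c *_) (forcedCoeff-thetaM J' (drop k I))) (suc (length I)) ⟩
  Σn (λ k → forcedCoeff1 (take k I) c * thetaMCoeff (drop k I) J') (suc (length I))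
    ≡⟨ recursion I ⟩
  thetaMCoeff I (c ∷ J') ∎
  where
  open ≡-Reasoning
  recursion : ∀ I → Σn (λ k → forcedCoeff1 (take k I) c * thetaMCoeff (drop k I) J') (suc (length I)) ≡ thetaMCoeff I (c ∷ J')
  recursion [] = cong (_+ 0ℚ) (QP.*-zeroˡ (thetaMCoeff [] J'))
  recursion (x ∷ r) = RecursionStep.recursion-holds x r c J'

-- Step 4: ordered compositions of a column x are the coarsenings of E_{cw(x)}
--
-- The compositions J with (x) ≼ J are the splittings of x into nonzero columns
-- whose supports are weakly increasing from left to right.  Reading each column
-- as a block of letters of cw(x) identifies them with the coarsenings of E_{cw(x)}.
-- We prove this at the level of sums Σ_J g(J) for an arbitrary weight g.

filterB-map : ∀ {A B : Set} (p : B → Bool) (f : A → B) L → filterB p (map f L) ≡ map f (filterB (p ∘ f) L)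
filterB-map p f [] = refl
filterB-map p f (x ∷ L) with p (f x)
... | true = cong (f x ∷_) (filterB-map p f L)
... | false = filterB-map p f L

allB-map : ∀ {A B : Set} (p : B → Bool) (f : A → B) L → allB p (map f L) ≡ allB (p ∘ f) L
allB-map p f [] = refl
allB-map p f (x ∷ L) = cong (p (f x) ∧_) (allB-map p f L)

allB-true : ∀ {A : Set} (L : List A) → allB (λ _ → true) L ≡ true
allB-true [] = refl
allB-true (x ∷ L) = allB-true L

allB-cong : ∀ {A : Set} (p q : A → Bool) → (∀ a → p a ≡ q a) → ∀ L → allB p L ≡ allB q L
allB-cong p q h [] = refl
allB-cong p q h (x ∷ L) = cong₂ _∧_ (h x) (allB-cong p q h L)

nullB : ∀ {A : Set} → List A → Bool
nullB [] = true
nullB (_ ∷ _) = false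

map-toℕ-suc : ∀ {ℓ} (L : List (Fin ℓ)) → map toℕ (map Fin.suc L) ≡ map suc (map toℕ L)
map-toℕ-suc [] = refl
map-toℕ-suc (x ∷ L) = cong (suc (toℕ x) ∷_) (map-toℕ-suc L)

supp-tail : ∀ {ℓ} (x0 : ℕ) (xs : Col ℓ) →
  map toℕ (filterB (λ i → not (Vec.lookup (x0 ∷ xs) i ≡ᵇ 0)) (tabulate Fin.suc)) ≡ map suc (supp xs)
supp-tail {ℓ} x0 xs
  rewrite sym (LP.map-tabulate {n = ℓ} (λ i → i) Fin.suc)
        | filterB-map (λ i → not (Vec.lookup (x0 ∷ xs) i ≡ᵇ 0)) Fin.suc (tabulate (λ i → i)) = map-toℕ-suc _

supp-cons : ∀ {ℓ} (x0 : ℕ) (xs : Col ℓ) → supp (x0 ∷ xs) ≡ (if not (x0 ≡ᵇ 0) then 0 ∷ map suc (supp xs) else map suc (supp xs))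
supp-cons x0 xs with not (x0 ≡ᵇ 0)
... | true = cong (0 ∷_) (supp-tail x0 xs)
... | false = supp-tail x0 xs

null-supp : ∀ {ℓ} (d : Col ℓ) → nullB (supp d) ≡ (wt d ≡ᵇ 0)
null-supp [] = refl
null-supp (zero ∷ xs) rewrite supp-cons zero xs = trans (null-shift (supp xs)) (null-supp xs)
  where null-shift : ∀ (L : List ℕ) → nullB (map suc L) ≡ nullB L
        null-shift [] = refl
        null-shift (_ ∷ _) = refl
null-supp (suc x0 ∷ xs) = refl

-- orderedAfter d d' : every index in supp d is ≤ every index in supp d',
-- computed coordinatewise (a nonzero entry of d' forbids later support in d)
orderedAfter : ∀ {ℓ} → Col ℓ → Col ℓ → Bool
orderedAfter [] [] = true
orderedAfter (a ∷ d) (b ∷ d') = ((wt d ≡ᵇ 0) ∨ (b ≡ᵇ 0)) ∧ orderedAfter d d'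

allLe : List ℕ → List ℕ → Bool
allLe S S' = allB (λ i → allB (λ j → i ≤ᵇ j) S') S

orderedPair : ∀ {ℓ} → Col ℓ → Col ℓ → Bool
orderedPair c d = allLe (supp c) (supp d)

allLe-0 : ∀ S S' → allLe (0 ∷ S) S' ≡ allLe S S'
allLe-0 S S' = cong (_∧ allLe S S') (trans (allB-cong _ (λ _ → true) (λ _ → refl) S') (allB-true S'))

suc≤ᵇ : ∀ m n → (suc m ≤ᵇ suc n) ≡ (m ≤ᵇ n)
suc≤ᵇ zero n = refl
suc≤ᵇ (suc m) n = refl

allLe-suc-0 : ∀ S S'' → allLe (map suc S) (0 ∷ S'') ≡ nullB S
allLe-suc-0 [] S'' = refl
allLe-suc-0 (x ∷ S) S'' = refl

allLe-suc : ∀ S S' → allLe (map suc S) (map suc S') ≡ allLe S S'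
allLe-suc S S' = trans (allB-map _ suc S) (allB-cong _ _ (λ i → trans (allB-map _ suc S') (allB-cong _ _ (λ j → suc≤ᵇ i j) S')) S)

orderedPair-orderedAfter : ∀ {ℓ} (d d' : Col ℓ) → orderedPair d d' ≡ orderedAfter d d'
orderedPair-orderedAfter [] [] = refl
orderedPair-orderedAfter (a ∷ d) (b ∷ d') = trans (cong₂ allLe (supp-cons a d) (supp-cons b d')) (trans (stripA a) (stripB b))
  where
  Sd = supp d
  Sd' = supp d'
  S' = if not (b ≡ᵇ 0) then 0 ∷ map suc Sd' else map suc Sd'
  stripA : ∀ a → allLe (if not (a ≡ᵇ 0) then 0 ∷ map suc Sd else map suc Sd) S' ≡ allLe (map suc Sd) S'
  stripA zero = refl
  stripA (suc a) = allLe-0 (map suc Sd) S'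
  fix : ∀ S → S ≡ Sd → nullB S ≡ (nullB S ∨ false) ∧ orderedAfter d d'
  fix [] e = sym (trans (sym (orderedPair-orderedAfter d d')) (cong (λ z → allLe z Sd') (sym e)))
  fix (_ ∷ _) e = refl
  stripB : ∀ b → allLe (map suc Sd) (if not (b ≡ᵇ 0) then 0 ∷ map suc Sd' else map suc Sd') ≡ ((wt d ≡ᵇ 0) ∨ (b ≡ᵇ 0)) ∧ orderedAfter d d'
  stripB zero = trans (allLe-suc Sd Sd') (trans (orderedPair-orderedAfter d d') (sym (cong (_∧ orderedAfter d d') (∨-zeroʳ (wt d ≡ᵇ 0)))))
  stripB (suc b) = trans (allLe-suc-0 Sd (map suc Sd')) (trans (fix Sd refl) (cong (λ z → (z ∨ false) ∧ orderedAfter d d') (null-supp d)))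

+≡ᵇ0 : ∀ m n → ((m ℕ.+ n) ≡ᵇ 0) ≡ (m ≡ᵇ 0) ∧ (n ≡ᵇ 0)
+≡ᵇ0 zero n = refl
+≡ᵇ0 (suc m) n = refl

orderedAfter-vadd : ∀ {ℓ} (d d1 d2 : Col ℓ) → orderedAfter d (vadd d1 d2) ≡ orderedAfter d d1 ∧ orderedAfter d d2
orderedAfter-vadd [] [] [] = refl
orderedAfter-vadd (a ∷ d) (b1 ∷ d1) (b2 ∷ d2) rewrite +≡ᵇ0 b1 b2 | orderedAfter-vadd d d1 d2 = distrib (wt d ≡ᵇ 0) (b1 ≡ᵇ 0) (b2 ≡ᵇ 0) (orderedAfter d d1) (orderedAfter d d2)
  where distrib : ∀ z p q r s → (z ∨ (p ∧ q)) ∧ (r ∧ s) ≡ ((z ∨ p) ∧ r) ∧ ((z ∨ q) ∧ s)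
        distrib true p q r s = refl
        distrib false false q r s = refl
        distrib false true true r s = refl
        distrib false true false true s = refl
        distrib false true false false s = refl

orderedAfter-vzero : ∀ {ℓ} (d : Col ℓ) → orderedAfter d vzero ≡ true
orderedAfter-vzero [] = refl
orderedAfter-vzero (a ∷ d) rewrite orderedAfter-vzero d = cong (_∧ true) (∨-zeroʳ (wt d ≡ᵇ 0))

allB-orderedPair : ∀ {ℓ} (d : Col ℓ) R → allB (orderedPair d) R ≡ orderedAfter d (vsum R)
allB-orderedPair d [] = sym (orderedAfter-vzero d)
allB-orderedPair d (d' ∷ R) = trans (cong₂ _∧_ (orderedPair-orderedAfter d d') (allB-orderedPair d R)) (sym (orderedAfter-vadd d d' (vsum R)))

below-complement : ∀ {ℓ} (v : Col ℓ) → All (λ d → vadd d (vsub v d) ≡ v) (below v)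
below-complement [] = refl ∷ []
below-complement (x ∷ v) = AllP.concat⁺ (AllP.map⁺ (AllP.applyUpTo⁺₁ (λ i → i) (suc x)
  (λ {i} i<sx → AllP.map⁺ (All.map (λ {ds} e → cong₂ _∷_ (NP.m+[n∸m]≡n (NP.≤-pred i<sx)) e) (below-complement v)))))

weight0⇒vzero : ∀ {ℓ} (v : Col ℓ) → (wt v ≡ᵇ 0) ≡ true → v ≡ vzero
weight0⇒vzero [] e = refl
weight0⇒vzero (zero ∷ v) e = cong (0 ∷_) (weight0⇒vzero v e)
weight0⇒vzero (suc x ∷ v) ()

compsF-vsum : ∀ {ℓ} n (v : Col ℓ) → All (λ R → vsum R ≡ v) (compsF n v)
compsF-vsum zero v with wt v ≡ᵇ 0 in e
... | true = sym (weight0⇒vzero v e) ∷ []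
... | false = []
compsF-vsum (suc n) v with wt v ≡ᵇ 0 in e
... | true = sym (weight0⇒vzero v e) ∷ []
... | false = AllP.concat⁺ (AllP.map⁺ (All.map (λ {d} e' → step d e') (below-complement v)))
  where
  step : ∀ d → vadd d (vsub v d) ≡ v → All (λ R → vsum R ≡ v) (if wt d ≡ᵇ 0 then [] else map (d ∷_) (compsF n (vsub v d)))
  step d e' with wt d ≡ᵇ 0
  ... | true = []
  ... | false = AllP.map⁺ (All.map (λ {R} eR → trans (cong (vadd d) eR) e') (compsF-vsum n (vsub v d)))

compsF-IsVComp : ∀ {ℓ} n (v : Col ℓ) → All IsVComp (compsF n v)
compsF-IsVComp zero v with wt v ≡ᵇ 0
... | true = [] ∷ []
... | false = []
compsF-IsVComp (suc n) v with wt v ≡ᵇ 0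
... | true = [] ∷ []
... | false = AllP.concat⁺ (AllP.map⁺ (All.universal step (below v)))
  where
  pos : ∀ d → (wt d ≡ᵇ 0) ≡ false → 0 ℕ.< wt d
  pos d e with wt d
  pos d () | zero
  ... | suc k = ℕ.s≤s ℕ.z≤n
  step : ∀ d → All IsVComp (if wt d ≡ᵇ 0 then [] else map (d ∷_) (compsF n (vsub v d)))
  step d with wt d ≡ᵇ 0 in e
  ... | true = []
  ... | false = AllP.map⁺ (All.map (λ vc → pos d e ∷ vc) (compsF-IsVComp n (vsub v d)))

-- colTake t x: the column formed by the first t letters of cw(x);
-- colDrop t x: the remaining letters
colTake : ∀ {ℓ} → ℕ → Col ℓ → Col ℓ
colTake t [] = []
colTake t (x0 ∷ xs) = (t ⊓ x0) ∷ colTake (t ∸ x0) xs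

colDrop : ∀ {ℓ} → ℕ → Col ℓ → Col ℓ
colDrop t x = vsub x (colTake t x)

colTake-zero : ∀ {ℓ} (x : Col ℓ) → colTake 0 x ≡ vzero
colTake-zero [] = refl
colTake-zero (x0 ∷ xs) = cong (0 ∷_) (trans (cong (λ t → colTake t xs) (NP.0∸n≡0 x0)) (colTake-zero xs))

sum-below-cons : ∀ {ℓ} (F : Col (suc ℓ) → ℚ) x0 (xs : Col ℓ) →
  sumℚ (map F (below (x0 ∷ xs))) ≡ Σn (λ i → sumℚ (map (λ ds → F (i ∷ ds)) (below xs))) (suc x0)
sum-below-cons F x0 xs = trans (sum-concatMap F (λ i → map (i ∷_) (below xs)) (λ i → sumℚ (map (λ ds → F (i ∷ ds)) (below xs)))
    (λ i → sum-map F (i ∷_) (below xs)) (upTo (suc x0)))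
  (sum-applyUpTo (λ i → sumℚ (map (λ ds → F (i ∷ ds)) (below xs))) (λ i → i) (suc x0))

sum-below-weight0 : ∀ {ℓ} (xs : Col ℓ) (f : Col ℓ → ℚ) → sumℚ (map (λ ds → indicator (wt ds ≡ᵇ 0) * f ds) (below xs)) ≡ f vzero
sum-below-weight0 [] f = trans (QP.+-identityʳ _) (QP.*-identityˡ (f []))
sum-below-weight0 (y ∷ ys) f = trans (sum-below-cons _ y ys) (trans (cong₂ _+_
    (trans (sum-cong _ _ (λ ds → refl) (below ys)) (sum-below-weight0 ys (λ ds → f (0 ∷ ds))))
  (Σn-zero _ (λ i → sum-zero _ (λ ds → QP.*-zeroˡ (f (suc i ∷ ds))) (below ys)) y)) (QP.+-identityʳ _))

orderedAfter-vzeroˡ : ∀ {ℓ} (v : Col ℓ) → orderedAfter vzero v ≡ true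
orderedAfter-vzeroˡ [] = refl
orderedAfter-vzeroˡ {suc ℓ} (b ∷ v) rewrite wt-vzero {ℓ} | orderedAfter-vzeroˡ v = refl

orderedAfter-weight0 : ∀ {ℓ} (ds v : Col ℓ) → (wt ds ≡ᵇ 0) ≡ true → orderedAfter ds v ≡ true
orderedAfter-weight0 ds v e rewrite weight0⇒vzero ds e = orderedAfter-vzeroˡ v

-- the weight of a column d that may start an ordered splitting of x
startWeight : ∀ {ℓ} → Col ℓ → (Col ℓ → ℚ) → Col ℓ → ℚ
startWeight x H d = indicator (not (wt d ≡ᵇ 0)) * (indicator (orderedAfter d (vsub x d)) * H d)

-- a first column starting with i < x₀ must vanish below its first coordinate
below-startShort : ∀ {ℓ} m (xs : Col ℓ) H i → i ℕ.< suc m →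
  sumℚ (map (λ ds → startWeight (suc m ∷ xs) H (i ∷ ds)) (below xs)) ≡ indicator (not (i ≡ᵇ 0)) * H (i ∷ vzero)
below-startShort m xs H i lt =
  trans (sum-cong _ (λ ds → indicator (wt ds ≡ᵇ 0) * (indicator (not (i ≡ᵇ 0)) * H (i ∷ ds))) pt (below xs))
        (sum-below-weight0 xs (λ ds → indicator (not (i ≡ᵇ 0)) * H (i ∷ ds)))
  where
  nz : (suc m ∸ i ≡ᵇ 0) ≡ false
  nz with suc m ∸ i | NP.m>n⇒m∸n≢0 lt
  ... | zero | ne = ⊥-elim (ne refl)
  ... | suc _ | _ = refl
  pt : ∀ ds → startWeight (suc m ∷ xs) H (i ∷ ds) ≡ indicator (wt ds ≡ᵇ 0) * (indicator (not (i ≡ᵇ 0)) * H (i ∷ ds))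
  pt ds rewrite nz | +≡ᵇ0 i (wt ds) with wt ds ≡ᵇ 0 in e
  ... | true rewrite orderedAfter-weight0 ds (vsub xs ds) e | ∧-identityʳ (i ≡ᵇ 0) =
        trans (cong (indicator (not (i ≡ᵇ 0)) *_) (QP.*-identityˡ (H (i ∷ ds)))) (sym (QP.*-identityˡ _))
  ... | false rewrite ∧-zeroʳ (i ≡ᵇ 0) =
        trans (cong (1ℚ *_) (QP.*-zeroˡ (H (i ∷ ds)))) (trans (QP.*-zeroʳ 1ℚ) (sym (QP.*-zeroˡ (indicator (not (i ≡ᵇ 0)) * H (i ∷ ds)))))

-- a first column using all x₀ letters 0 is followed by an ordered start in xs (or nothing)
below-startFull : ∀ {ℓ} m (xs : Col ℓ) H →
  sumℚ (map (λ ds → startWeight (suc m ∷ xs) H (suc m ∷ ds)) (below xs)) ≡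
  H (suc m ∷ vzero) + sumℚ (map (startWeight xs (λ ds → H (suc m ∷ ds))) (below xs))
below-startFull m xs H = trans (sum-cong _ (λ ds → indicator (wt ds ≡ᵇ 0) * H (suc m ∷ ds) + startWeight xs (λ ds → H (suc m ∷ ds)) ds) pt (below xs))
  (trans (sum-+ _ _ (below xs)) (cong (_+ sumℚ (map (startWeight xs (λ ds → H (suc m ∷ ds))) (below xs))) (sum-below-weight0 xs (λ ds → H (suc m ∷ ds)))))
  where
  pt : ∀ ds → startWeight (suc m ∷ xs) H (suc m ∷ ds) ≡ indicator (wt ds ≡ᵇ 0) * H (suc m ∷ ds) + startWeight xs (λ ds → H (suc m ∷ ds)) ds
  pt ds rewrite NP.n∸n≡0 m | ∨-zeroʳ (wt ds ≡ᵇ 0) with wt ds ≡ᵇ 0 in e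
  ... | true rewrite orderedAfter-weight0 ds (vsub xs ds) e =
        S.solve 1 (λ h → S.con 1ℚ S.:* (S.con 1ℚ S.:* h) S.:= S.con 1ℚ S.:* h S.:+ S.con 0ℚ S.:* (S.con 1ℚ S.:* h)) refl (H (suc m ∷ ds))
  ... | false = S.solve 2 (λ o h → S.con 1ℚ S.:* (o S.:* h) S.:= S.con 0ℚ S.:* h S.:+ S.con 1ℚ S.:* (o S.:* h)) refl
                  (indicator (orderedAfter ds (vsub xs ds))) (H (suc m ∷ ds))

-- the first t+1 letters of cw(x₀ ∷ xs): first the letters 0, then those of xs
Σn-colTake-cons : ∀ {ℓ} m (xs : Col ℓ) (H : Col (suc ℓ) → ℚ) →
  Σn (λ t → H (colTake (suc t) (suc m ∷ xs))) (suc m ℕ.+ wt xs) ≡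
  Σn (λ t → H (suc t ∷ vzero)) (suc m) + Σn (λ t → H (suc m ∷ colTake (suc t) xs)) (wt xs)
Σn-colTake-cons m xs H = trans (Σn-split f (suc m) (wt xs)) (cong₂ _+_ (Σn-congB f _ (suc m) low) (Σn-cong _ _ high (wt xs)))
  where
  f = λ t → H (colTake (suc t) (suc m ∷ xs))
  low : ∀ t → t ℕ.< suc m → f t ≡ H (suc t ∷ vzero)
  low t lt = cong H (cong₂ _∷_ (NP.m≤n⇒m⊓n≡m lt) (trans (cong (λ z → colTake z xs) (NP.m≤n⇒m∸n≡0 lt)) (colTake-zero xs)))
  high : ∀ t → f (suc m ℕ.+ t) ≡ H (suc m ∷ colTake (suc t) xs)
  high t = cong H (cong₂ _∷_ (NP.m≥n⇒m⊓n≡n (ℕ.s≤s (NP.m≤n⇒m≤1+n (NP.m≤m+n m t))))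
    (cong (λ z → colTake z xs) (trans (cong (_∸ suc m) (sym (NP.+-suc (suc m) t))) (NP.m+n∸m≡n (suc m) (suc t)))))

-- Choosing the first column d of an ordered splitting of x is the same as
-- choosing how many letters t+1 of cw(x) it consumes: d = colTake (t+1) x.
below-split : ∀ {ℓ} (x : Col ℓ) (H : Col ℓ → ℚ) →
  sumℚ (map (startWeight x H) (below x)) ≡ Σn (λ t → H (colTake (suc t) x)) (wt x)
below-split [] H = trans (QP.+-identityʳ (0ℚ * (1ℚ * H []))) (QP.*-zeroˡ (1ℚ * H []))
below-split (zero ∷ xs) H = trans (sum-below-cons _ zero xs) (trans (QP.+-identityʳ _)
  (trans (sum-cong _ _ (λ ds → cong (λ b → indicator (not (wt ds ≡ᵇ 0)) * (indicator b * H (0 ∷ ds)))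
                                    (cong (_∧ orderedAfter ds (vsub xs ds)) (∨-zeroʳ (wt ds ≡ᵇ 0)))) (below xs))
         (below-split xs (λ ds → H (0 ∷ ds)))))
below-split {suc ℓ} (suc m ∷ xs) H = begin
  sumℚ (map (startWeight (suc m ∷ xs) H) (below (suc m ∷ xs)))
    ≡⟨ trans (sum-below-cons _ (suc m) xs) (Σn-last A (suc m)) ⟩
  Σn A (suc m) + A (suc m)
    ≡⟨ cong₂ _+_ (Σn-congB A (λ i → indicator (not (i ≡ᵇ 0)) * H (i ∷ vzero)) (suc m) (below-startShort m xs H))
                 (trans (below-startFull m xs H) (cong (H (suc m ∷ vzero) +_) (below-split xs (λ ds → H (suc m ∷ ds))))) ⟩
  Σn (λ i → indicator (not (i ≡ᵇ 0)) * H (i ∷ vzero)) (suc m) + (H (suc m ∷ vzero) + Rest)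
    ≡⟨ cong (_+ (H (suc m ∷ vzero) + Rest))
         (trans (cong₂ _+_ (QP.*-zeroˡ (H (0 ∷ vzero))) (Σn-cong (λ i → 1ℚ * H (suc i ∷ vzero)) (λ t → H (suc t ∷ vzero))
             (λ i → QP.*-identityˡ (H (suc i ∷ vzero))) m))
                (QP.+-identityˡ (Σn (λ t → H (suc t ∷ vzero)) m))) ⟩
  Σn (λ t → H (suc t ∷ vzero)) m + (H (suc m ∷ vzero) + Rest)
    ≡⟨ sym (trans (cong (_+ Rest) (Σn-last (λ t → H (suc t ∷ vzero)) m)) (QP.+-assoc (Σn (λ t → H (suc t ∷ vzero)) m) (H (suc m ∷ vzero)) Rest)) ⟩
  Σn (λ t → H (suc t ∷ vzero)) (suc m) + Rest
    ≡⟨ sym (Σn-colTake-cons m xs H) ⟩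
  Σn (λ t → H (colTake (suc t) (suc m ∷ xs))) (suc m ℕ.+ wt xs) ∎
  where
  open ≡-Reasoning
  A = λ i → sumℚ (map (λ ds → startWeight (suc m ∷ xs) H (i ∷ ds)) (below xs))
  Rest = Σn (λ t → H (suc m ∷ colTake (suc t) xs)) (wt xs)

-- Σ over ordered splittings of x, described letter by letter
-- (fuel n ≥ |x|): first column colTake (t+1) x, then recursively on the rest
splitSum : ∀ {ℓ} → ℕ → Col ℓ → (VC ℓ → ℚ) → ℚ
splitSum zero x g = if wt x ≡ᵇ 0 then g [] else 0ℚ
splitSum (suc n) x g = if wt x ≡ᵇ 0 then g [] else Σn (λ t → splitSum n (colDrop (suc t) x) (λ R → g (colTake (suc t) x ∷ R))) (wt x)

wt≤ : ∀ {ℓ} n (x d : Col ℓ) → wt x ℕ.≤ suc n → vadd d (vsub x d) ≡ x → (wt d ≡ᵇ 0) ≡ false → wt (vsub x d) ℕ.≤ n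
wt≤ n x d le e nz = NP.+-cancelˡ-≤ 1 (wt (vsub x d)) n (NP.≤-trans (NP.+-monoˡ-≤ (wt (vsub x d)) (pos (wt d) nz))
    (NP.≤-trans (NP.≤-reflexive (trans (sym (wt-vadd d (vsub x d))) (cong wt e))) le))
  where pos : ∀ k → (k ≡ᵇ 0) ≡ false → 1 ℕ.≤ k
        pos zero ()
        pos (suc k) _ = ℕ.s≤s ℕ.z≤n

orderedComps-split : ∀ {ℓ} n (x : Col ℓ) (g : VC ℓ → ℚ) → wt x ℕ.≤ n → sumℚ (map g (filterB orderedB (compsF n x))) ≡ splitSum n x g
orderedComps-split zero x g le with wt x ≡ᵇ 0 in e
... | true = QP.+-identityʳ (g [])
orderedComps-split zero x g le | false with wt x | le
... | zero | _ = case e of λ ()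
orderedComps-split (suc n) x g le with wt x ≡ᵇ 0 in e
... | true = QP.+-identityʳ (g [])
... | false = begin
  sumℚ (map g (filterB orderedB (concatMap fd (below x))))
    ≡⟨ sum-filter orderedB g (concatMap fd (below x)) ⟩
  sumℚ (map (λ R → indicator (orderedB R) * g R) (concatMap fd (below x)))
    ≡⟨ sum-concatMap _ fd φ (λ d → refl) (below x) ⟩
  sumℚ (map φ (below x))
    ≡⟨ sum-cong-All φ _ (below x) (below-complement x) φeq ⟩
  sumℚ (map (startWeight x (λ d → splitSum n (vsub x d) (λ R → g (d ∷ R)))) (below x))
    ≡⟨ below-split x (λ d → splitSum n (vsub x d) (λ R → g (d ∷ R))) ⟩
  Σn (λ t → splitSum n (colDrop (suc t) x) (λ R → g (colTake (suc t) x ∷ R))) (wt x) ∎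
  where
  open ≡-Reasoning
  fd : Col _ → List (VC _)
  fd d = if wt d ≡ᵇ 0 then [] else map (d ∷_) (compsF n (vsub x d))
  φ : Col _ → ℚ
  φ d = sumℚ (map (λ R → indicator (orderedB R) * g R) (fd d))
  -- the ordered compositions starting with d: d ordered before the rest, which is ordered
  φeq : ∀ d → vadd d (vsub x d) ≡ x → φ d ≡ startWeight x (λ d → splitSum n (vsub x d) (λ R → g (d ∷ R))) d
  φeq d ed with wt d ≡ᵇ 0 in nz
  ... | true = sym (QP.*-zeroˡ (indicator (orderedAfter d (vsub x d)) * splitSum n (vsub x d) (λ R → g (d ∷ R))))
  ... | false = trans (sum-map (λ R → indicator (orderedB R) * g R) (d ∷_) (compsF n (vsub x d)))
      (trans (sum-cong-All _ (λ R → indicator (orderedAfter d (vsub x d)) * (indicator (orderedB R) * g (d ∷ R))) (compsF n (vsub x d))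
          (compsF-vsum n (vsub x d))
               (λ R eR → trans (cong (_* g (d ∷ R)) (trans (indicator-∧ (allB (orderedPair d) R) (orderedB R))
                   (cong (_* indicator (orderedB R)) (cong indicator (trans (allB-orderedPair d R) (cong (orderedAfter d) eR))))))
                         (QP.*-assoc (indicator (orderedAfter d (vsub x d))) (indicator (orderedB R)) (g (d ∷ R)))))
      (trans (sum-scale (indicator (orderedAfter d (vsub x d))) (λ R → indicator (orderedB R) * g (d ∷ R)) (compsF n (vsub x d)))
      (trans (cong (indicator (orderedAfter d (vsub x d)) *_) (trans (sym (sum-filter orderedB (λ R → g (d ∷ R)) (compsF n (vsub x d))))
                (orderedComps-split n (vsub x d) (λ R → g (d ∷ R)) (wt≤ n x d le ed nz))))
       (sym (QP.*-identityˡ _)))))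

-- Σ over the coarsenings of a K, organised by the length of the first block
module FirstBlock {ℓ} (g : VC ℓ → ℚ) where
  mergedHead : Col ℓ → VC ℓ → ℚ
  mergedHead acc [] = 0ℚ
  mergedHead acc (b ∷ c) = g (vadd acc b ∷ c)

  firstBlockSum : Col ℓ → VC ℓ → ℚ
  firstBlockSum acc K = sumℚ (map (mergedHead acc) (coarsenings K))

  firstBlockSum-cons : ∀ acc a K → firstBlockSum acc (a ∷ K) ≡ sumℚ (map (λ c → g (vadd acc a ∷ c)) (coarsenings K)) + firstBlockSum (vadd acc a) K
  firstBlockSum-cons acc a K = trans (sum-concatMap (mergedHead acc) _ (λ c → g (vadd acc a ∷ c) + mergedHead (vadd acc a) c) pt (coarsenings K))
    (sum-+ (λ c → g (vadd acc a ∷ c)) (mergedHead (vadd acc a)) (coarsenings K))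
    where
    pt : (c : VC ℓ) → _
    pt [] = refl
    pt (b ∷ c) = cong (g (vadd acc a ∷ b ∷ c) +_) (trans (QP.+-identityʳ _) (cong (λ z → g (z ∷ c)) (sym (vadd-assoc acc a b))))

  firstBlockSum-closed : ∀ acc K → firstBlockSum acc K ≡ Σn (λ t → sumℚ
      (map (λ J' → g (vadd acc (vsum (take (suc t) K)) ∷ J')) (coarsenings (drop (suc t) K)))) (length K)
  firstBlockSum-closed acc [] = refl
  firstBlockSum-closed acc (a ∷ K) = trans (firstBlockSum-cons acc a K) (cong₂ _+_
    (sum-cong _ _ (λ c → cong (λ z → g (vadd acc z ∷ c)) (sym (vadd-zeroʳ a))) (coarsenings K))
    (trans (firstBlockSum-closed (vadd acc a) K) (Σn-cong _ _ (λ t → sum-cong _ _ (λ J' → cong (λ z → g (z ∷ J')) (vadd-assoc acc a _))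
        (coarsenings (drop (suc t) K))) (length K))))

  coarsenings-firstBlock : ∀ a K → sumℚ (map g (coarsenings (a ∷ K))) ≡ Σn (λ t → sumℚ
      (map (λ J' → g (vsum (take (suc t) (a ∷ K)) ∷ J')) (coarsenings (drop (suc t) (a ∷ K))))) (suc (length K))
  coarsenings-firstBlock a K = trans (trans (sum-concatMap g _ (λ c → g (a ∷ c) + mergedHead a c) pt (coarsenings K))
                        (trans firstBlockSum-start (sym (firstBlockSum-cons vzero a K))))
           (trans (firstBlockSum-closed vzero (a ∷ K)) (Σn-cong _ _ (λ t → sum-cong _ _
               (λ J' → cong (λ z → g (z ∷ J')) (vadd-zeroˡ (vsum (take (suc t) (a ∷ K))))) (coarsenings (drop (suc t) (a ∷ K)))) (suc (length K))))
    where
    pt : (c : VC ℓ) → _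
    pt [] = refl
    pt (b ∷ c) = cong (g (a ∷ b ∷ c) +_) (QP.+-identityʳ _)
    firstBlockSum-start : sumℚ (map (λ c → g (a ∷ c) + mergedHead a c) (coarsenings K)) ≡ sumℚ (map (λ c → g (vadd vzero a ∷ c))
        (coarsenings K)) + firstBlockSum (vadd vzero a) K
    firstBlockSum-start rewrite vadd-zeroˡ a = sum-+ _ _ (coarsenings K)

cwCol : ∀ {ℓ} → Col ℓ → List (Fin ℓ)
cwCol {ℓ} x = concatMap (λ i → replicate (Vec.lookup x i) i) (List.allFin ℓ)

cwCol-cons : ∀ {ℓ} x0 (xs : Col ℓ) → cwCol (x0 ∷ xs) ≡ replicate x0 Fin.zero ++ map Fin.suc (cwCol xs)
cwCol-cons {ℓ} x0 xs = cong (replicate x0 Fin.zero ++_) (begin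
  concatMap (λ i → replicate (Vec.lookup (x0 ∷ xs) i) i) (tabulate Fin.suc)
    ≡⟨ cong (concatMap (λ i → replicate (Vec.lookup (x0 ∷ xs) i) i)) (sym (LP.map-tabulate {n = ℓ} (λ i → i) Fin.suc)) ⟩
  concatMap (λ i → replicate (Vec.lookup (x0 ∷ xs) i) i) (map Fin.suc (List.allFin ℓ))
    ≡⟨ LP.concatMap-map _ Fin.suc (List.allFin ℓ) ⟩
  concatMap (λ i → replicate (Vec.lookup xs i) (Fin.suc i)) (List.allFin ℓ)
    ≡⟨ LP.concatMap-cong (λ i → sym (LP.map-replicate Fin.suc (Vec.lookup xs i) i)) (List.allFin ℓ) ⟩
  concatMap (λ i → map Fin.suc (replicate (Vec.lookup xs i) i)) (List.allFin ℓ)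
    ≡⟨ sym (LP.map-concatMap Fin.suc (λ i → replicate (Vec.lookup xs i) i) (List.allFin ℓ)) ⟩
  map Fin.suc (cwCol xs) ∎)
  where open ≡-Reasoning

unitCol0 : ∀ {ℓ} → unitCol {suc ℓ} Fin.zero ≡ 1 ∷ vzero
unitCol0 {ℓ} = cong (1 ∷_) (tab0 ℓ)
  where tab0 : ∀ ℓ → Vec.tabulate {n = ℓ} (λ _ → 0) ≡ Vec.replicate ℓ 0
        tab0 zero = refl
        tab0 (suc ℓ) = cong (0 ∷_) (tab0 ℓ)

vsumE-rep : ∀ {ℓ} k → vsum (E {suc ℓ} (replicate k Fin.zero)) ≡ k ∷ vzero
vsumE-rep zero = refl
vsumE-rep {ℓ} (suc k) rewrite unitCol0 {ℓ} | vsumE-rep {ℓ} k = cong (suc k ∷_) (vadd-zeroˡ vzero)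

vsumE-suc : ∀ {ℓ} (w : List (Fin ℓ)) → vsum (E (map Fin.suc w)) ≡ 0 ∷ vsum (E w)
vsumE-suc [] = refl
vsumE-suc (i ∷ w) rewrite vsumE-suc w = refl

length-cwCol : ∀ {ℓ} (x : Col ℓ) → length (cwCol x) ≡ wt x
length-cwCol [] = refl
length-cwCol (x0 ∷ xs) = trans (cong length (cwCol-cons x0 xs)) (trans (LP.length-++ (replicate x0 Fin.zero))
    (cong₂ ℕ._+_ (LP.length-replicate x0) (trans (LP.length-map Fin.suc (cwCol xs)) (length-cwCol xs))))

take-rep-++ : ∀ {A : Set} t k (a : A) L → take t (replicate k a ++ L) ≡ replicate (t ⊓ k) a ++ take (t ∸ k) L
take-rep-++ zero k a L rewrite NP.0∸n≡0 k = refl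
take-rep-++ (suc t) zero a L = refl
take-rep-++ (suc t) (suc k) a L = cong (a ∷_) (take-rep-++ t k a L)

drop-rep-++ : ∀ {A : Set} t k (a : A) L → drop t (replicate k a ++ L) ≡ replicate (k ∸ t) a ++ drop (t ∸ k) L
drop-rep-++ zero k a L rewrite NP.0∸n≡0 k = refl
drop-rep-++ (suc t) zero a L = refl
drop-rep-++ (suc t) (suc k) a L = drop-rep-++ t k a L

∸⊓ : ∀ x t → x ∸ (t ⊓ x) ≡ x ∸ t
∸⊓ x zero = refl
∸⊓ zero (suc t) = refl
∸⊓ (suc x) (suc t) = ∸⊓ x t

vsumE-take : ∀ {ℓ} t (x : Col ℓ) → vsum (E (take t (cwCol x))) ≡ colTake t x
vsumE-take t [] rewrite LP.take-[] {A = Fin 0} t = refl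
vsumE-take {suc ℓ} t (x0 ∷ xs) = begin
  vsum (E (take t (cwCol (x0 ∷ xs)))) ≡⟨ cong (λ w → vsum (E (take t w))) (cwCol-cons x0 xs) ⟩
  vsum (E (take t (replicate x0 Fin.zero ++ map Fin.suc (cwCol xs))))
     ≡⟨ cong (λ w → vsum (E w)) (trans (take-rep-++ t x0 Fin.zero (map Fin.suc (cwCol xs)))
         (cong (replicate (t ⊓ x0) Fin.zero ++_) (LP.take-map {f = Fin.suc} (t ∸ x0) (cwCol xs)))) ⟩
  vsum (E (rp ++ map Fin.suc w')) ≡⟨ cong vsum (LP.map-++ unitCol rp (map Fin.suc w')) ⟩
  vsum (E rp ++ E (map Fin.suc w')) ≡⟨ vsum-++ (E rp) (E (map Fin.suc w')) ⟩
  vadd (vsum (E rp)) (vsum (E (map Fin.suc w'))) ≡⟨ cong₂ vadd (vsumE-rep {ℓ} (t ⊓ x0)) (vsumE-suc w') ⟩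
  vadd ((t ⊓ x0) ∷ vzero) (0 ∷ vsum (E w')) ≡⟨ cong₂ _∷_ (NP.+-identityʳ (t ⊓ x0)) (trans (vadd-zeroˡ (vsum (E w'))) (vsumE-take (t ∸ x0) xs)) ⟩
  colTake t (x0 ∷ xs) ∎
  where
  open ≡-Reasoning
  rp = replicate (t ⊓ x0) (Fin.zero {ℓ})
  w' = take (t ∸ x0) (cwCol xs)

drop-cwCol : ∀ {ℓ} t (x : Col ℓ) → drop t (cwCol x) ≡ cwCol (colDrop t x)
drop-cwCol t [] = LP.drop-[] t
drop-cwCol t (x0 ∷ xs) rewrite cwCol-cons x0 xs | drop-rep-++ t x0 Fin.zero (map Fin.suc (cwCol xs)) | LP.drop-map {f = Fin.suc} (t ∸ x0) (cwCol xs)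
  | drop-cwCol (t ∸ x0) xs | cwCol-cons (x0 ∸ (t ⊓ x0)) (vsub xs (colTake (t ∸ x0) xs)) | ∸⊓ x0 t = refl

length0⇒[] : ∀ {A : Set} (L : List A) → length L ≡ 0 → L ≡ []
length0⇒[] [] _ = refl

splitSum-coarsenings : ∀ {ℓ} n (x : Col ℓ) (g : VC ℓ → ℚ) → wt x ℕ.≤ n → splitSum n x g ≡ sumℚ (map g (coarsenings (E (cwCol x))))
splitSum-coarsenings zero x g le with wt x ≡ᵇ 0 in e
... | true rewrite length0⇒[] (cwCol x) (trans (length-cwCol x) (NP.≡ᵇ⇒≡ (wt x) 0 (subst T (sym e) _))) = sym (QP.+-identityʳ (g []))
splitSum-coarsenings zero x g le | false with wt x | le
... | zero | _ = case e of λ ()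
splitSum-coarsenings {ℓ} (suc n) x g le with wt x ≡ᵇ 0 in e
... | true rewrite length0⇒[] (cwCol x) (trans (length-cwCol x) (NP.≡ᵇ⇒≡ (wt x) 0 (subst T (sym e) _))) = sym (QP.+-identityʳ (g []))
... | false = trans (Σn-cong _ _ step (wt x)) (sym (final (cwCol x) refl))
  where
  w = cwCol x
  step : ∀ t → splitSum n (colDrop (suc t) x) (λ R → g (colTake (suc t) x ∷ R)) ≡
               sumℚ (map (λ J' → g (vsum (take (suc t) (E w)) ∷ J')) (coarsenings (drop (suc t) (E w))))
  step t = trans (splitSum-coarsenings n (colDrop (suc t) x) (λ R → g (colTake (suc t) x ∷ R)) fuel)
    (trans (cong (λ z → sumℚ (map (λ J' → g (z ∷ J')) (coarsenings (E (cwCol (colDrop (suc t) x))))))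
        (sym (trans (cong vsum (LP.take-map {f = unitCol} (suc t) w)) (vsumE-take (suc t) x))))
           (cong (λ L → sumℚ (map (λ J' → g (vsum (take (suc t) (E w)) ∷ J')) (coarsenings L)))
               (sym (trans (LP.drop-map {f = unitCol} (suc t) w) (cong E (drop-cwCol (suc t) x))))))
    where
    fuel : wt (colDrop (suc t) x) ℕ.≤ n
    fuel = subst (ℕ._≤ n) (trans (sym (trans (LP.length-drop (suc t) w) (cong (ℕ._∸ suc t) (length-cwCol x))))
        (trans (cong length (drop-cwCol (suc t) x)) (length-cwCol (colDrop (suc t) x))))
             (NP.≤-trans (NP.∸-monoʳ-≤ {1} {suc t} (wt x) (ℕ.s≤s ℕ.z≤n)) (NP.≤-trans (NP.∸-monoˡ-≤ 1 le) NP.≤-refl))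
  final : ∀ w' → w' ≡ w → sumℚ (map g (coarsenings (E w'))) ≡ Σn (λ t → sumℚ
      (map (λ J' → g (vsum (take (suc t) (E w')) ∷ J')) (coarsenings (drop (suc t) (E w'))))) (wt x)
  final [] ew = case subst (λ z → (z ≡ᵇ 0) ≡ false) (trans (sym (length-cwCol x)) (cong length (sym ew))) e of λ ()
  final (i ∷ w') ew = trans (FirstBlock.coarsenings-firstBlock g (unitCol i) (E w'))
    (cong (Σn _) (trans (cong suc (LP.length-map unitCol w')) (trans (cong length ew) (length-cwCol x))))

orderedComps-coarsenings : ∀ {ℓ} (x : Col ℓ) (g : VC ℓ → ℚ) → sumℚ (map g (filterB orderedB (comps x))) ≡ sumℚ (map g (coarsenings (E (cwCol x))))
orderedComps-coarsenings x g = trans (orderedComps-split (wt x) x g NP.≤-refl) (splitSum-coarsenings (wt x) x g NP.≤-refl)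

-- Step 5: coarsenings and refinements as flag vectors

-- all 0/1 vectors of length n (true = "cut here")
allFlags : ℕ → List (List Bool)
allFlags zero = [] ∷ []
allFlags (suc n) = map (true ∷_) (allFlags n) ++ map (false ∷_) (allFlags n)

allFlags-length : ∀ n → All (λ a → length a ≡ n) (allFlags n)
allFlags-length zero = refl ∷ []
allFlags-length (suc n) = AllP.++⁺ (AllP.map⁺ (All.map (cong suc) (allFlags-length n)))
                               (AllP.map⁺ (All.map (cong suc) (allFlags-length n)))

sumFlags : ℕ → (List Bool → ℚ) → ℚ
sumFlags n f = sumℚ (map f (allFlags n))

sumFlags-suc : ∀ n f → sumFlags (suc n) f ≡ sumFlags n (λ b → f (true ∷ b)) + sumFlags n (λ b → f (false ∷ b))
sumFlags-suc n f = trans (sum-++ f (map (true ∷_) (allFlags n)) (map (false ∷_) (allFlags n)))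
  (cong₂ _+_ (sum-map f (true ∷_) (allFlags n)) (sum-map f (false ∷_) (allFlags n)))

sumFlags-cong : ∀ n f g → (∀ b → f b ≡ g b) → sumFlags n f ≡ sumFlags n g
sumFlags-cong n f g h = sum-cong f g h (allFlags n)

sumFlags-congL : ∀ n f g → (∀ b → length b ≡ n → f b ≡ g b) → sumFlags n f ≡ sumFlags n g
sumFlags-congL n f g h = sum-cong-All f g (allFlags n) (allFlags-length n) h

sumFlags-++ : ∀ p q f → sumFlags (p ℕ.+ q) f ≡ sumFlags p (λ b1 → sumFlags q (λ b2 → f (b1 ++ b2)))
sumFlags-++ zero q f = sym (QP.+-identityʳ _)
sumFlags-++ (suc p) q f = trans (sumFlags-suc (p ℕ.+ q) f) (trans (cong₂ _+_ (sumFlags-++ p q (λ b → f (true ∷ b))) (sumFlags-++ p q (λ b → f (false ∷ b))))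
    (sym (sumFlags-suc p _)))

-- head and tail of a flag vector, padding with false
hd : List Bool → Bool
hd [] = false
hd (x ∷ _) = x

tl : List Bool → List Bool
tl [] = []
tl (_ ∷ b) = b

-- merge e r b: the coarsening of (e r) that keeps the gaps flagged true and
-- merges the columns across the gaps flagged false
merge : ∀ {ℓ} → Col ℓ → VC ℓ → List Bool → VC ℓ
merge e [] b = e ∷ []
merge e (y ∷ r) b = if hd b then e ∷ merge y r (tl b) else addHead e (merge y r (tl b))

-- flagsLe a T: every cut of a is a cut of T (so merge a is a coarsening of merge T)
flagsLe : List Bool → List Bool → Bool
flagsLe [] T = true
flagsLe (x ∷ a) T = (not x ∨ hd T) ∧ flagsLe a (tl T)

flagsLe-cons : ∀ a T → flagsLe a T ≡ (not (hd a) ∨ hd T) ∧ flagsLe (tl a) (tl T)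
flagsLe-cons [] T = refl
flagsLe-cons (x ∷ a) T = refl

merge-nonempty : ∀ {ℓ} (e : Col ℓ) r b → ∃₂ λ f rs → merge e r b ≡ f ∷ rs
merge-nonempty e [] b = e , [] , refl
merge-nonempty e (y ∷ r) b with hd b | merge-nonempty y r (tl b)
... | true | f , rs , eq = e , merge y r (tl b) , refl
... | false | f , rs , eq rewrite eq = vadd e f , rs , refl

merge-addHead : ∀ {ℓ} (acc e : Col ℓ) r b → addHead acc (merge e r b) ≡ merge (vadd acc e) r b
merge-addHead acc e [] b = refl
merge-addHead acc e (y ∷ r) b with hd b
... | true = refl
... | false = addHead-addHead acc e (merge y r (tl b))

merge-allTrue : ∀ {ℓ} (e : Col ℓ) r → merge e r (replicate (length r) true) ≡ e ∷ r
merge-allTrue e [] = refl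
merge-allTrue e (y ∷ r) = cong (e ∷_) (merge-allTrue y r)

merge-++ : ∀ {ℓ} (e1 : Col ℓ) r1 e2 r2 b1 b2 → length b1 ≡ length r1 → merge e1 (r1 ++ e2 ∷ r2) (b1 ++ true ∷ b2) ≡ merge e1 r1 b1 ++ merge e2 r2 b2
merge-++ e1 [] e2 r2 [] b2 _ = refl
merge-++ e1 (y ∷ r1) e2 r2 (c ∷ b1) b2 lb with c | merge-nonempty y r1 b1
... | true | _ = cong (e1 ∷_) (merge-++ y r1 e2 r2 b1 b2 (NP.suc-injective lb))
... | false | f , rs , eq = trans (cong (addHead e1) (merge-++ y r1 e2 r2 b1 b2 (NP.suc-injective lb)))
     (trans (cong (λ z → addHead e1 (z ++ merge e2 r2 b2)) eq) (cong (_++ merge e2 r2 b2) (cong (addHead e1) (sym eq))))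

flagsLe-allTrue : ∀ a → flagsLe a (replicate (length a) true) ≡ true
flagsLe-allTrue [] = refl
flagsLe-allTrue (x ∷ a) rewrite flagsLe-allTrue a | ∨-zeroʳ (not x) = refl

flagsLe-falses : ∀ k b → flagsLe (replicate k false) b ≡ true
flagsLe-falses zero b = refl
flagsLe-falses (suc k) b = flagsLe-falses k (tl b)

flagsLe-falses-++ : ∀ k L b1 L' → length b1 ≡ k → flagsLe (replicate k false ++ L) (b1 ++ L') ≡ flagsLe L L'
flagsLe-falses-++ zero L [] L' _ = refl
flagsLe-falses-++ (suc k) L (c ∷ b1) L' lb = flagsLe-falses-++ k L b1 L' (NP.suc-injective lb)

mergeFirst : ∀ {ℓ} → (VC ℓ → ℚ) → Col ℓ → VC ℓ → ℚ
mergeFirst h a [] = 0ℚ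
mergeFirst h a (b ∷ c) = h (vadd a b ∷ c)

-- a coarsening of a K: a is either its own block or merged into the first block
sum-coarsenings-cons : ∀ {ℓ} (h : VC ℓ → ℚ) a K → sumℚ (map h (coarsenings (a ∷ K))) ≡ sumℚ (map (λ c → h (a ∷ c) + mergeFirst h a c) (coarsenings K))
sum-coarsenings-cons h a K = sum-concatMap h _ (λ c → h (a ∷ c) + mergeFirst h a c) pt (coarsenings K)
  where pt : (c : VC _) → _
        pt [] = refl
        pt (b ∷ c) = cong (h (a ∷ b ∷ c) +_) (QP.+-identityʳ _)

sum-coarsenings-addHead : ∀ {ℓ} (h : VC ℓ → ℚ) e m K → sumℚ (map h (coarsenings (addHead e (m ∷ K)))) ≡ sumℚ (map (λ c → h (addHead e c)) (coarsenings (m ∷ K)))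
sum-coarsenings-addHead h e m K = trans (sum-coarsenings-cons h (vadd e m) K) (sym (trans (sum-coarsenings-cons (λ c → h (addHead e c)) m K)
  (sum-cong _ _ pt (coarsenings K))))
  where pt : (c : VC _) → _
        pt [] = refl
        pt (b ∷ c) = cong (h (vadd e m ∷ b ∷ c) +_) (cong (λ z → h (z ∷ c)) (sym (vadd-assoc e m b)))

coarsenings-nonempty : ∀ {ℓ} (m : Col ℓ) K → All (λ c → c ≢ []) (coarsenings (m ∷ K))
coarsenings-nonempty m K = AllP.concat⁺ (AllP.map⁺ (All.universal pt (coarsenings K)))
  where pt : (c : VC _) → All (λ c → c ≢ []) ((m ∷ c) ∷ _)
        pt [] = (λ ()) ∷ []
        pt (b ∷ c) = (λ ()) ∷ (λ ()) ∷ []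

sum-coarsenings-split : ∀ {ℓ} (h : VC ℓ → ℚ) e f rs →
  sumℚ (map h (coarsenings (e ∷ f ∷ rs))) ≡
  sumℚ (map (λ c → h (e ∷ c)) (coarsenings (f ∷ rs))) + sumℚ (map (λ c → h (addHead e c)) (coarsenings (f ∷ rs)))
sum-coarsenings-split h e f rs =
  trans (sum-coarsenings-cons h e (f ∷ rs))
  (trans (sum-cong-All _ (λ c → h (e ∷ c) + h (addHead e c)) (coarsenings (f ∷ rs)) (coarsenings-nonempty f rs) nonempty)
         (sum-+ (λ c → h (e ∷ c)) (λ c → h (addHead e c)) (coarsenings (f ∷ rs))))
  where
  nonempty : ∀ c → c ≢ [] → h (e ∷ c) + mergeFirst h e c ≡ h (e ∷ c) + h (addHead e c)
  nonempty [] ne = ⊥-elim (ne refl)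
  nonempty (b ∷ c) ne = refl

sumFlags-le-cut : ∀ n T (g : List Bool → ℚ) → hd T ≡ true →
  sumFlags (suc n) (λ a → indicator (flagsLe a T) * g a) ≡
  sumFlags n (λ a → indicator (flagsLe a (tl T)) * g (true ∷ a)) + sumFlags n (λ a → indicator (flagsLe a (tl T)) * g (false ∷ a))
sumFlags-le-cut n T g hT = trans (sumFlags-suc n _)
  (cong (_+ sumFlags n (λ a → indicator (flagsLe a (tl T)) * g (false ∷ a)))
        (sumFlags-cong n _ _ (λ a → cong (λ z → indicator (z ∧ flagsLe a (tl T)) * g (true ∷ a)) hT)))

sumFlags-le-merged : ∀ n T (g : List Bool → ℚ) → hd T ≡ false →
  sumFlags (suc n) (λ a → indicator (flagsLe a T) * g a) ≡ sumFlags n (λ a → indicator (flagsLe a (tl T)) * g (false ∷ a))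
sumFlags-le-merged n T g hT = trans (sumFlags-suc n _)
  (trans (cong (_+ sumFlags n (λ a → indicator (flagsLe a (tl T)) * g (false ∷ a)))
               (trans (sumFlags-cong n _ (λ _ → 0ℚ) (λ a → trans (cong (λ z → indicator (z ∧ flagsLe a (tl T)) * g (true ∷ a)) hT)
                                                                  (QP.*-zeroˡ (g (true ∷ a)))))
                      (sum-zero (λ _ → 0ℚ) (λ _ → refl) (allFlags n))))
         (QP.+-identityˡ _))

coarsenings-merge : ∀ {ℓ} (e : Col ℓ) r T (h : VC ℓ → ℚ) →
  sumℚ (map h (coarsenings (merge e r T))) ≡ sumFlags (length r) (λ a → indicator (flagsLe a T) * h (merge e r a))
coarsenings-merge e [] T h = trans (QP.+-identityʳ (h (e ∷ []))) (sym (trans (QP.+-identityʳ _) (QP.*-identityˡ (h (e ∷ [])))))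
coarsenings-merge e (y ∷ r) T h with hd T in hT | merge-nonempty y r (tl T)
... | true | f , rs , eq = begin
  sumℚ (map h (coarsenings (e ∷ Mm)))
    ≡⟨ cong (λ z → sumℚ (map h (coarsenings (e ∷ z)))) eq ⟩
  sumℚ (map h (coarsenings (e ∷ f ∷ rs)))
    ≡⟨ sum-coarsenings-split h e f rs ⟩
  sumℚ (map (λ c → h (e ∷ c)) (coarsenings (f ∷ rs))) + sumℚ (map (λ c → h (addHead e c)) (coarsenings (f ∷ rs)))
    ≡⟨ cong (λ z → sumℚ (map (λ c → h (e ∷ c)) (coarsenings z)) + sumℚ (map (λ c → h (addHead e c)) (coarsenings z))) (sym eq) ⟩
  sumℚ (map (λ c → h (e ∷ c)) (coarsenings Mm)) + sumℚ (map (λ c → h (addHead e c)) (coarsenings Mm))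
    ≡⟨ cong₂ _+_ (coarsenings-merge y r (tl T) (λ c → h (e ∷ c))) (coarsenings-merge y r (tl T) (λ c → h (addHead e c))) ⟩
  sumFlags (length r) (λ a → indicator (flagsLe a (tl T)) * h (e ∷ merge y r a))
    + sumFlags (length r) (λ a → indicator (flagsLe a (tl T)) * h (addHead e (merge y r a)))
    ≡⟨ sym (sumFlags-le-cut (length r) T (λ a → h (merge e (y ∷ r) a)) hT) ⟩
  sumFlags (suc (length r)) (λ a → indicator (flagsLe a T) * h (merge e (y ∷ r) a)) ∎
  where
  open ≡-Reasoning
  Mm = merge y r (tl T)
... | false | f , rs , eq = begin
  sumℚ (map h (coarsenings (addHead e Mm)))
    ≡⟨ cong (λ z → sumℚ (map h (coarsenings (addHead e z)))) eq ⟩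
  sumℚ (map h (coarsenings (addHead e (f ∷ rs))))
    ≡⟨ sum-coarsenings-addHead h e f rs ⟩
  sumℚ (map (λ c → h (addHead e c)) (coarsenings (f ∷ rs)))
    ≡⟨ cong (λ z → sumℚ (map (λ c → h (addHead e c)) (coarsenings z))) (sym eq) ⟩
  sumℚ (map (λ c → h (addHead e c)) (coarsenings Mm))
    ≡⟨ coarsenings-merge y r (tl T) (λ c → h (addHead e c)) ⟩
  sumFlags (length r) (λ a → indicator (flagsLe a (tl T)) * h (addHead e (merge y r a)))
    ≡⟨ sym (sumFlags-le-merged (length r) T (λ a → h (merge e (y ∷ r) a)) hT) ⟩
  sumFlags (suc (length r)) (λ a → indicator (flagsLe a T) * h (merge e (y ∷ r) a)) ∎
  where
  open ≡-Reasoning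
  Mm = merge y r (tl T)

coarsenings-flags : ∀ {ℓ} (e : Col ℓ) r (h : VC ℓ → ℚ) → sumℚ (map h (coarsenings (e ∷ r))) ≡ sumFlags (length r) (λ a → h (merge e r a))
coarsenings-flags e r h = trans (cong (λ z → sumℚ (map h (coarsenings z))) (sym (merge-allTrue e r)))
  (trans (coarsenings-merge e r (replicate (length r) true) h)
  (sumFlags-congL (length r) _ _ (λ a la → trans (cong (λ z → indicator (flagsLe a (replicate z true)) * h (merge e r a)) (sym la))
      (trans (cong (λ z → indicator z * h (merge e r a)) (flagsLe-allTrue a)) (QP.*-identityˡ _)))))

-- descentFlags I: the flag vector on the gaps of cw(I) that cuts exactly between
-- the columns of I
descentFlags : ∀ {ℓ} → VC ℓ → List Bool
descentFlags [] = []
descentFlags (x ∷ []) = replicate (wt x ∸ 1) false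
descentFlags (x ∷ y ∷ I) = replicate (wt x ∸ 1) false ++ true ∷ descentFlags (y ∷ I)

cwCol-nonempty : ∀ {ℓ} (x : Col ℓ) → 0 ℕ.< wt x → ∃₂ λ i w → cwCol x ≡ i ∷ w
cwCol-nonempty x p with cwCol x | length-cwCol x
... | [] | e = ⊥-elim (NP.<-irrefl e p)
... | i ∷ w | _ = i , w , refl

length-E-tail : ∀ {ℓ} (x : Col ℓ) i w → cwCol x ≡ i ∷ w → length (E w) ≡ wt x ∸ 1
length-E-tail x i w e = trans (LP.length-map unitCol w) (cong (_∸ 1) (trans (cong length (sym e)) (length-cwCol x)))

refinements-cons : ∀ {ℓ} (x : Col ℓ) I' (h : VC ℓ → ℚ) → sumℚ (map h (refinements (x ∷ I'))) ≡
  sumℚ (map (λ Jc → sumℚ (map (λ R' → h (Jc ++ R')) (refinements I'))) (coarsenings (E (cwCol x))))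
refinements-cons x I' h = trans (sum-concatMap h (λ Jc → map (Jc ++_) (refinements I')) _ (λ Jc → sum-map h (Jc ++_) (refinements I'))
    (filterB orderedB (comps x)))
  (orderedComps-coarsenings x (λ Jc → sumℚ (map (λ R' → h (Jc ++ R')) (refinements I'))))

-- Flag vectors b₁ ++ b₂ that must cut at the gap after r₁ (d = falses, cut, d₂):
-- only b₂ starting with a cut survives, and the merge splits there.
sumFlags-forcedCut : ∀ {ℓ} k (e₁ : Col ℓ) r₁ e₂ r₂ d₂ (h : VC ℓ → ℚ) b₁ → length b₁ ≡ length r₁ → length r₁ ≡ k →
  sumFlags (suc (length r₂)) (λ b₂ → indicator (flagsLe (replicate k false ++ true ∷ d₂) (b₁ ++ b₂)) * h (merge e₁ (r₁ ++ e₂ ∷ r₂) (b₁ ++ b₂)))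
  ≡ sumFlags (length r₂) (λ b₂ → indicator (flagsLe d₂ b₂) * h (merge e₁ r₁ b₁ ++ merge e₂ r₂ b₂))
sumFlags-forcedCut k e₁ r₁ e₂ r₂ d₂ h b₁ lb lk = begin
  sumFlags (suc n) G
    ≡⟨ sumFlags-suc n G ⟩
  sumFlags n (λ b₂ → G (true ∷ b₂)) + sumFlags n (λ b₂ → G (false ∷ b₂))
    ≡⟨ cong₂ _+_ (sumFlags-cong n _ _ cut) (trans (sumFlags-cong n _ (λ _ → 0ℚ) noCut) (sum-zero (λ _ → 0ℚ) (λ _ → refl) (allFlags n))) ⟩
  sumFlags n (λ b₂ → indicator (flagsLe d₂ b₂) * h (merge e₁ r₁ b₁ ++ merge e₂ r₂ b₂)) + 0ℚ
    ≡⟨ QP.+-identityʳ _ ⟩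
  sumFlags n (λ b₂ → indicator (flagsLe d₂ b₂) * h (merge e₁ r₁ b₁ ++ merge e₂ r₂ b₂)) ∎
  where
  open ≡-Reasoning
  n = length r₂
  G = λ b₂ → indicator (flagsLe (replicate k false ++ true ∷ d₂) (b₁ ++ b₂)) * h (merge e₁ (r₁ ++ e₂ ∷ r₂) (b₁ ++ b₂))
  lk' = trans lb lk
  cut : ∀ b₂ → G (true ∷ b₂) ≡ indicator (flagsLe d₂ b₂) * h (merge e₁ r₁ b₁ ++ merge e₂ r₂ b₂)
  cut b₂ = cong₂ (λ u v → indicator u * h v) (flagsLe-falses-++ k (true ∷ d₂) b₁ (true ∷ b₂) lk') (merge-++ e₁ r₁ e₂ r₂ b₁ b₂ lb)
  noCut : ∀ b₂ → G (false ∷ b₂) ≡ 0ℚ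
  noCut b₂ = trans (cong (λ u → indicator u * h (merge e₁ (r₁ ++ e₂ ∷ r₂) (b₁ ++ false ∷ b₂))) (flagsLe-falses-++ k (true ∷ d₂) b₁ (false ∷ b₂) lk'))
                   (QP.*-zeroˡ (h (merge e₁ (r₁ ++ e₂ ∷ r₂) (b₁ ++ false ∷ b₂))))

-- The refinements R of I (I ≼ R) are the merges of E_{cw(I)} by the flag vectors
-- that cut at least between the columns of I.
refinements-flags : ∀ {ℓ} (x : Col ℓ) I' i w → cwCol x ≡ i ∷ w → IsVComp I' → ∀ (h : VC ℓ → ℚ) →
  sumℚ (map h (refinements (x ∷ I'))) ≡ sumFlags (length (E w ++ E (cw I'))) (λ b → indicator (flagsLe (descentFlags (x ∷ I')) b) * h
      (merge (unitCol i) (E w ++ E (cw I')) b))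
refinements-flags x [] i w cx _ h = begin
  sumℚ (map h (refinements (x ∷ [])))
    ≡⟨ refinements-cons x [] h ⟩
  sumℚ (map (λ Jc → h (Jc ++ []) + 0ℚ) (coarsenings (E (cwCol x))))
    ≡⟨ cong (λ z → sumℚ (map (λ Jc → h (Jc ++ []) + 0ℚ) (coarsenings (E z)))) cx ⟩
  sumℚ (map (λ Jc → h (Jc ++ []) + 0ℚ) (coarsenings (unitCol i ∷ E w)))
    ≡⟨ coarsenings-flags (unitCol i) (E w) _ ⟩
  sumFlags (length (E w)) (λ b → h (merge (unitCol i) (E w) b ++ []) + 0ℚ)
    ≡⟨ sym (trans (cong (λ z → sumFlags (length z) (λ b → indicator (flagsLe (descentFlags (x ∷ [])) b) * h (merge (unitCol i) z b))) (LP.++-identityʳ (E w)))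
              (sumFlags-cong (length (E w)) _ _ (λ b → trans (cong (λ z → indicator z * h (merge (unitCol i) (E w) b)) (flagsLe-falses (wt x ∸ 1) b))
                 (trans (QP.*-identityˡ _) (trans (cong h (sym (LP.++-identityʳ (merge (unitCol i) (E w) b)))) (sym (QP.+-identityʳ _))))))) ⟩
  sumFlags (length (E w ++ [])) (λ b → indicator (flagsLe (descentFlags (x ∷ [])) b) * h (merge (unitCol i) (E w ++ []) b)) ∎
  where open ≡-Reasoning
refinements-flags x (y ∷ I'') i w cx (py ∷ vI) h with cwCol-nonempty y py
... | i2 , w2 , cy = begin
  sumℚ (map h (refinements (x ∷ y ∷ I'')))
    ≡⟨ refinements-cons x (y ∷ I'') h ⟩
  sumℚ (map restSum (coarsenings (E (cwCol x))))
    ≡⟨ cong (λ z → sumℚ (map restSum (coarsenings (E z)))) cx ⟩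
  sumℚ (map restSum (coarsenings (unitCol i ∷ E w)))
    ≡⟨ coarsenings-flags (unitCol i) (E w) restSum ⟩
  sumFlags (length (E w)) (λ b1 → restSum (merge (unitCol i) (E w) b1))
    ≡⟨ sumFlags-cong (length (E w)) _ _ (λ b1 → refinements-flags y I'' i2 w2 cy vI (λ R' → h (merge (unitCol i) (E w) b1 ++ R'))) ⟩
  sumFlags (length (E w)) (λ b1 → sumFlags (length r2) (λ b2 → indicator (flagsLe d2 b2) * h (merge (unitCol i) (E w) b1 ++ merge e2 r2 b2)))
    ≡⟨ sumFlags-congL (length (E w)) _ _ (λ b1 lb → sym (sumFlags-forcedCut (wt x ∸ 1) (unitCol i) (E w) e2 r2 d2 h b1 lb (length-E-tail x i w cx))) ⟩
  sumFlags (length (E w)) (λ b1 → sumFlags (suc (length r2)) (λ b2 → flagged (b1 ++ b2)))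
    ≡⟨ sym (trans (cong (λ z → sumFlags z flagged) (LP.length-++ (E w))) (sumFlags-++ (length (E w)) (suc (length r2)) flagged)) ⟩
  sumFlags (length (E w ++ e2 ∷ r2)) flagged
    ≡⟨ cong (λ z → sumFlags (length (E w ++ z)) (λ b → indicator (flagsLe (descentFlags (x ∷ y ∷ I'')) b) * h (merge (unitCol i) (E w ++ z) b))) (sym eE) ⟩
  sumFlags (length (E w ++ E (cw (y ∷ I'')))) (λ b → indicator (flagsLe (descentFlags (x ∷ y ∷ I'')) b) * h (merge (unitCol i) (E w ++ E (cw (y ∷ I''))) b)) ∎
  where
  open ≡-Reasoning
  restSum = λ Jc → sumℚ (map (λ R' → h (Jc ++ R')) (refinements (y ∷ I'')))
  e2 = unitCol i2
  r2 = E w2 ++ E (cw I'')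
  d2 = descentFlags (y ∷ I'')
  eE : E (cw (y ∷ I'')) ≡ e2 ∷ r2
  eE = trans (LP.map-++ unitCol (cwCol y) (cw I'')) (cong (λ z → E z ++ E (cw I'')) cy)
  flagged = λ b → indicator (flagsLe (descentFlags (x ∷ y ∷ I'')) b) * h (merge (unitCol i) (E w ++ e2 ∷ r2) b)

filterB-All : ∀ {A : Set} {P : A → Set} (p : A → Bool) L → All P L → All P (filterB p L)
filterB-All p [] [] = []
filterB-All p (x ∷ L) (px ∷ pL) with p x
... | true = px ∷ filterB-All p L pL
... | false = filterB-All p L pL

refinements-IsVComp : ∀ {ℓ} (I : VC ℓ) → All IsVComp (refinements I)
refinements-IsVComp [] = [] ∷ []
refinements-IsVComp (x ∷ I) = AllP.concat⁺ (AllP.map⁺ (go (filterB orderedB (comps x)) (filterB-All orderedB (comps x) (compsF-IsVComp (wt x) x))))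
  where
  go : ∀ L → All IsVComp L → All (λ Jc → All IsVComp (map (Jc ++_) (refinements I))) L
  go [] [] = []
  go (Jc ∷ L) (pJ ∷ pL) = AllP.map⁺ (All.map (λ pR → AllP.++⁺ pJ pR) (refinements-IsVComp I)) ∷ go L pL

-- Step 6: Θ on a merge, and the alternating sum over refinements

-- oddFlags e r b: the flag vector whose merge is odd(merge e r b), i.e. cutting
-- only after the blocks of odd weight; lastOddFlag: whether the last block is odd
oddFlags : ∀ {ℓ} → Col ℓ → VC ℓ → List Bool → List Bool
oddFlags e [] b = []
oddFlags e (y ∷ r) b = if hd b then isOdd (wt e) ∷ oddFlags y r (tl b) else false ∷ oddFlags (vadd e y) r (tl b)

lastOddFlag : ∀ {ℓ} → Col ℓ → VC ℓ → List Bool → Bool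
lastOddFlag e [] b = isOdd (wt e)
lastOddFlag e (y ∷ r) b = if hd b then lastOddFlag y r (tl b) else lastOddFlag (vadd e y) r (tl b)

lastOdd-merge : ∀ {ℓ} (e : Col ℓ) r b → lastOdd (merge e r b) ≡ lastOddFlag e r b
lastOdd-merge e [] b = refl
lastOdd-merge e (y ∷ r) b with hd b | merge-nonempty y r (tl b)
... | true | f , rs , eq rewrite eq = trans (sym (cong lastOdd eq)) (lastOdd-merge y r (tl b))
... | false | f , rs , eq = trans (cong lastOdd (merge-addHead e y r (tl b))) (lastOdd-merge (vadd e y) r (tl b))

oddPart-merge : ∀ {ℓ} (e : Col ℓ) r b → lastOddFlag e r b ≡ true → oddPart (merge e r b) ≡ merge e r (oddFlags e r b)
oddPart-merge e [] b l rewrite l = cong (_∷ []) (vadd-zeroˡ e)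
oddPart-merge e (y ∷ r) b l with hd b
... | true = fin (isOdd (wt e)) refl
  where
  Mm = merge y r (tl b)
  ih = oddPart-merge y r (tl b) l
  fin : ∀ p → isOdd (wt e) ≡ p → oddGo vzero (e ∷ Mm) ≡ (if p then e ∷ merge y r (oddFlags y r (tl b)) else addHead e (merge y r (oddFlags y r (tl b))))
  fin true ep rewrite ep = cong₂ _∷_ (vadd-zeroˡ e) ih
  fin false ep rewrite ep = trans (oddGo-acc (vadd vzero e) Mm) (cong₂ addHead (vadd-zeroˡ e) ih)
... | false = trans (cong oddPart (merge-addHead e y r (tl b))) (trans (oddPart-merge (vadd e y) r (tl b) l)
    (sym (merge-addHead e y r (oddFlags (vadd e y) r (tl b)))))

thetaMCoeff-merge : ∀ {ℓ} (e : Col ℓ) r b J → thetaMCoeff (merge e r b) J ≡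
  indicator (lastOddFlag e r b) * (sign (length (merge e r b) ℕ.+ totwt (merge e r b)) *
      (pow2 (length J) * sumFlags (length r) (λ a → indicator (flagsLe a (oddFlags e r b)) * indicator (does (J ≟VC merge e r a)))))
thetaMCoeff-merge e r b J = go (merge e r b) refl (merge-nonempty e r b)
  where
  go : ∀ R → R ≡ merge e r b → ∃₂ (λ f rs → merge e r b ≡ f ∷ rs) → thetaMCoeff R J ≡
    indicator (lastOddFlag e r b) * (sign (length R ℕ.+ totwt R) * (pow2 (length J) * sumFlags (length r)
        (λ a → indicator (flagsLe a (oddFlags e r b)) * indicator (does (J ≟VC merge e r a)))))
  go [] eR (f , rs , eq) = ⊥-elim (nil (trans eR eq))
    where nil : [] ≡ f ∷ rs → ⊥
          nil ()
  go R@(_ ∷ _) eR _ = trans (cong (λ c → if c then Sg * (pow2 (length J) * coarseningCount (oddPart R) J) else 0ℚ)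
      (trans (cong lastOdd eR) (lastOdd-merge e r b)))
                              (fin (lastOddFlag e r b) refl)
    where
    Sg = sign (length R ℕ.+ totwt R)
    Σa = sumFlags (length r) (λ a → indicator (flagsLe a (oddFlags e r b)) * indicator (does (J ≟VC merge e r a)))
    fin : ∀ c → lastOddFlag e r b ≡ c → (if c then Sg * (pow2 (length J) * coarseningCount (oddPart R) J) else 0ℚ) ≡ indicator c * (Sg * (pow2 (length J) * Σa))
    fin true el = trans (cong (λ z → Sg * (pow2 (length J) * z))
         (trans (cong (λ z → coarseningCount z J) (trans (cong oddPart eR) (oddPart-merge e r b el)))
             (coarsenings-merge e r (oddFlags e r b) (λ J' → indicator (does (J ≟VC J'))))))
         (sym (QP.*-identityˡ _))
    fin false _ = sym (QP.*-zeroˡ (Sg * (pow2 (length J) * Σa)))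

signB : Bool → ℚ
signB true = 1ℚ
signB false = - 1ℚ

sgn-step : ∀ w L T → sign (suc L ℕ.+ (w ℕ.+ T)) ≡ signB (isOdd w) * sign (L ℕ.+ T)
sgn-step w L T = trans (sign-split w T L) (trans (sym (QP.*-assoc (- 1ℚ) (sign w) (sign (L ℕ.+ T)))) (cong (_* sign (L ℕ.+ T)) (lem (isOdd w))))
  where lem : ∀ b → - 1ℚ * (if b then - 1ℚ else 1ℚ) ≡ signB b
        lem true = refl
        lem false = refl

-- the summand of Θ(F_I) at M_{merge a}, for the refinement merge b of I
-- (d = descentFlags I), up to the factor 2^{len J}
signedTerm : ∀ {ℓ} → Col ℓ → VC ℓ → List Bool → List Bool → List Bool → ℚ
signedTerm e r d a b = indicator (flagsLe d b) * (indicator (lastOddFlag e r b) *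
    (indicator (flagsLe a (oddFlags e r b)) * sign (length (merge e r b) ℕ.+ totwt (merge e r b))))

signedTerm-true : ∀ {ℓ} (e y : Col ℓ) r d a b → signedTerm e (y ∷ r) d a (true ∷ b) ≡ indicator (not (hd a) ∨ isOdd (wt e)) * (signB
    (isOdd (wt e)) * signedTerm y r (tl d) (tl a) b)
signedTerm-true e y r d a b = begin
  indicator (flagsLe d (true ∷ b)) * (indicator (lastOddFlag y r b) * (indicator (flagsLe a (isOdd (wt e) ∷ oddFlags y r b)) * sign
      (length (e ∷ Mm) ℕ.+ totwt (e ∷ Mm))))
    ≡⟨ cong₂ (λ u v → indicator u * (indicator (lastOddFlag y r b) * (indicator v * sign (length (e ∷ Mm) ℕ.+ totwt (e ∷ Mm)))))
         (trans (flagsLe-cons d (true ∷ b)) (cong (_∧ flagsLe (tl d) b) (∨-zeroʳ (not (hd d))))) (flagsLe-cons a (isOdd (wt e) ∷ oddFlags y r b)) ⟩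
  indicator (flagsLe (tl d) b) * (indicator (lastOddFlag y r b) * (indicator (q ∧ flagsLe (tl a) (oddFlags y r b)) * sign
      (suc (length Mm) ℕ.+ (wt e ℕ.+ totwt Mm))))
    ≡⟨ cong₂ (λ u v → indicator (flagsLe (tl d) b) * (indicator (lastOddFlag y r b) * (u * v))) (indicator-∧ q (flagsLe (tl a) (oddFlags y r b))) (sgn-step
        (wt e) (length Mm) (totwt Mm)) ⟩
  indicator (flagsLe (tl d) b) * (indicator (lastOddFlag y r b) * (indicator q * indicator (flagsLe (tl a) (oddFlags y r b)) * (signB (isOdd (wt e)) * S)))
    ≡⟨ S.solve 6 (λ A B Q C E T → A S.:* (B S.:* (Q S.:* C S.:* (E S.:* T))) S.:= Q S.:* (E S.:* (A S.:* (B S.:* (C S.:* T))))) refl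
         (indicator (flagsLe (tl d) b)) (indicator (lastOddFlag y r b)) (indicator q) (indicator (flagsLe (tl a) (oddFlags y r b))) (signB (isOdd (wt e))) S ⟩
  indicator q * (signB (isOdd (wt e)) * signedTerm y r (tl d) (tl a) b) ∎
  where
  open ≡-Reasoning
  Mm = merge y r b
  q = not (hd a) ∨ isOdd (wt e)
  S = sign (length Mm ℕ.+ totwt Mm)

signedTerm-false : ∀ {ℓ} (e y : Col ℓ) r d a b → signedTerm e (y ∷ r) d a (false ∷ b) ≡ indicator (not (hd d)) * (indicator (not (hd a)) * signedTerm
    (vadd e y) r (tl d) (tl a) b)
signedTerm-false e y r d a b = begin
  indicator (flagsLe d (false ∷ b)) * (indicator (lastOddFlag (vadd e y) r b) *
      (indicator (flagsLe a (false ∷ oddFlags (vadd e y) r b)) * sign (length (addHead e (merge y r b)) ℕ.+ totwt (addHead e (merge y r b)))))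
    ≡⟨ cong₂ (λ u v → indicator u * (indicator (lastOddFlag (vadd e y) r b) * (indicator v * sign (length X ℕ.+ totwt X))))
         (trans (flagsLe-cons d (false ∷ b)) (cong (_∧ flagsLe (tl d) b) (∨-identityʳ (not (hd d))))) (trans (flagsLe-cons a (false ∷ oddFlags (vadd e y) r b))
             (cong (_∧ flagsLe (tl a) (oddFlags (vadd e y) r b)) (∨-identityʳ (not (hd a))))) ⟩
  indicator (not (hd d) ∧ flagsLe (tl d) b) * (indicator (lastOddFlag (vadd e y) r b) *
      (indicator (not (hd a) ∧ flagsLe (tl a) (oddFlags (vadd e y) r b)) * sign (length X ℕ.+ totwt X)))
    ≡⟨ cong₂ (λ u v → u * (indicator (lastOddFlag (vadd e y) r b) * (v * sign (length X ℕ.+ totwt X)))) (indicator-∧ (not (hd d))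
        (flagsLe (tl d) b)) (indicator-∧ (not (hd a)) (flagsLe (tl a) (oddFlags (vadd e y) r b))) ⟩
  indicator (not (hd d)) * indicator (flagsLe (tl d) b) * (indicator (lastOddFlag (vadd e y) r b) *
      (indicator (not (hd a)) * indicator (flagsLe (tl a) (oddFlags (vadd e y) r b)) * sign (length X ℕ.+ totwt X)))
    ≡⟨ cong (λ z → indicator (not (hd d)) * indicator (flagsLe (tl d) b) *
        (indicator (lastOddFlag (vadd e y) r b) * (indicator (not (hd a)) * indicator (flagsLe (tl a) (oddFlags (vadd e y) r b)) * sign
        (length z ℕ.+ totwt z)))) (merge-addHead e y r b) ⟩
  indicator (not (hd d)) * indicator (flagsLe (tl d) b) * (indicator (lastOddFlag (vadd e y) r b) *
      (indicator (not (hd a)) * indicator (flagsLe (tl a) (oddFlags (vadd e y) r b)) * S))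
    ≡⟨ S.solve 6 (λ D A L N C T → D S.:* A S.:* (L S.:* (N S.:* C S.:* T)) S.:= D S.:* (N S.:* (A S.:* (L S.:* (C S.:* T))))) refl
         (indicator (not (hd d))) (indicator (flagsLe (tl d) b)) (indicator (lastOddFlag (vadd e y) r b)) (indicator (not (hd a))) (indicator
             (flagsLe (tl a) (oddFlags (vadd e y) r b))) S ⟩
  indicator (not (hd d)) * (indicator (not (hd a)) * signedTerm (vadd e y) r (tl d) (tl a) b) ∎
  where
  open ≡-Reasoning
  X = addHead e (merge y r b)
  S = sign (length (merge (vadd e y) r b) ℕ.+ totwt (merge (vadd e y) r b))

-- the inner sum over b, after exchanging the sums over a and b
signedSum : ∀ {ℓ} → Col ℓ → VC ℓ → List Bool → List Bool → ℚ
signedSum e r d a = sumFlags (length r) (signedTerm e r d a)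

signedSum-cons : ∀ {ℓ} (e y : Col ℓ) r d a → signedSum e (y ∷ r) d a ≡
  indicator (not (hd a) ∨ isOdd (wt e)) * (signB (isOdd (wt e)) * signedSum y r (tl d) (tl a)) + indicator (not (hd d)) * (indicator (not (hd a)) * signedSum
      (vadd e y) r (tl d) (tl a))
signedSum-cons e y r d a = trans (sumFlags-suc (length r) (signedTerm e (y ∷ r) d a)) (cong₂ _+_
  (trans (sumFlags-cong (length r) _ _ (signedTerm-true e y r d a)) (trans (sum-scale q _ (allFlags (length r)))
      (cong (q *_) (sum-scale (signB (isOdd (wt e))) _ (allFlags (length r))))))
  (trans (sumFlags-cong (length r) _ _ (signedTerm-false e y r d a)) (trans (sum-scale (indicator (not (hd d))) _ (allFlags (length r)))
      (cong (indicator (not (hd d)) *_) (sum-scale (indicator (not (hd a))) _ (allFlags (length r)))))))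
  where q = indicator (not (hd a) ∨ isOdd (wt e))

-- the same recursion for a word of single letters, with p the parity of the
-- current block
signedSumP : Bool → ℕ → List Bool → List Bool → ℚ
signedSumP p zero d a = indicator (flagsLe d []) * (indicator p * indicator (flagsLe a []))
signedSumP p (suc n) d a = indicator (not (hd a) ∨ p) * (signB p * signedSumP true n (tl d) (tl a)) + indicator (not (hd d)) * (indicator
    (not (hd a)) * signedSumP (not p) n (tl d) (tl a))

isOdd-+1 : ∀ w → isOdd (w ℕ.+ 1) ≡ not (isOdd w)
isOdd-+1 w = trans (cong isOdd (NP.+-comm w 1)) (isOdd-suc w)

-- on a word of single letters the parity of a block flips with each merged letter
signedSum-unitColumns : ∀ {ℓ} (e : Col ℓ) r d a → All (λ c → wt c ≡ 1) r → signedSum e r d a ≡ signedSumP (isOdd (wt e)) (length r) d a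
signedSum-unitColumns e [] d a [] = trans (QP.+-identityʳ _) (cong (indicator (flagsLe d []) *_) (lem (isOdd (wt e)) refl))
  where
  lem : ∀ p → isOdd (wt e) ≡ p → indicator p * (indicator (flagsLe a []) * sign (1 ℕ.+ (wt e ℕ.+ 0))) ≡ indicator p * indicator (flagsLe a [])
  lem true ep = trans (cong (λ z → 1ℚ * (indicator (flagsLe a []) * z)) evenLength) (cong (1ℚ *_) (QP.*-identityʳ (indicator (flagsLe a []))))
    where evenLength : sign (1 ℕ.+ (wt e ℕ.+ 0)) ≡ 1ℚ
          evenLength = trans (cong (λ z → sign (suc z)) (NP.+-identityʳ (wt e))) (trans (sign-suc (wt e)) (cong (λ b → - (if b then - 1ℚ else 1ℚ)) ep))
  lem false ep = trans (QP.*-zeroˡ (indicator (flagsLe a []) * sign (1 ℕ.+ (wt e ℕ.+ 0)))) (sym (QP.*-zeroˡ (indicator (flagsLe a []))))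
signedSum-unitColumns e (y ∷ r) d a (wy ∷ wr) = trans (signedSum-cons e y r d a) (cong₂ _+_
  (cong (λ z → indicator (not (hd a) ∨ isOdd (wt e)) * (signB (isOdd (wt e)) * z))
      (trans (signedSum-unitColumns y r (tl d) (tl a) wr) (cong (λ w → signedSumP (isOdd w) (length r) (tl d) (tl a)) wy)))
  (cong (λ z → indicator (not (hd d)) * (indicator (not (hd a)) * z)) (trans (signedSum-unitColumns (vadd e y) r (tl d) (tl a) wr)
     (cong (λ p → signedSumP p (length r) (tl d) (tl a)) (trans (cong isOdd (trans (wt-vadd e y) (cong (wt e ℕ.+_) wy))) (isOdd-+1 (wt e)))))))

-- the letter-by-letter test that every peak (a gap of d preceded by a merged gap,
-- i.e. the end of a column of weight ≥ 2) is cut by a or is just after a cut of a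
peakOK : ℕ → Bool → Bool → List Bool → List Bool → Bool
peakOK zero pk ap d a = true
peakOK (suc n) pk ap d a = (if hd d ∧ pk then hd a ∨ ap else true) ∧ peakOK n (not (hd d)) (hd a) (tl d) (tl a)

signedSum-closed : ∀ n pk ap d a → length d ≡ n → length a ≡ n → signedSumP true n d a + indicator (pk ∧ not ap) * signedSumP false n d a
    ≡ indicator (peakOK n pk ap d a)
signedSum-closed zero pk ap [] [] _ _ = S.solve 1 (λ i → S.con 1ℚ S.:* (S.con 1ℚ S.:* S.con 1ℚ) S.:+ i S.:*
    (S.con 1ℚ S.:* (S.con 0ℚ S.:* S.con 1ℚ)) S.:= S.con 1ℚ) refl (indicator (pk ∧ not ap))
signedSum-closed (suc n) pk ap (d0 ∷ d) (a0 ∷ a) ld la = go d0 a0 pk ap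
  where
  Vt = signedSumP true n d a
  Vf = signedSumP false n d a
  ld' = NP.suc-injective ld
  la' = NP.suc-injective la
  go : ∀ d0 a0 pk ap → signedSumP true (suc n) (d0 ∷ d) (a0 ∷ a) + indicator (pk ∧ not ap) * signedSumP false (suc n) (d0 ∷ d) (a0 ∷ a) ≡ indicator (peakOK
      (suc n) pk ap (d0 ∷ d) (a0 ∷ a))
  go false false pk ap = trans (S.solve 3 (λ t f i → S.con 1ℚ S.:* (S.con 1ℚ S.:* t) S.:+ S.con 1ℚ S.:* (S.con 1ℚ S.:* f) S.:+ i S.:*
      (S.con 1ℚ S.:* (S.con (- 1ℚ) S.:* t) S.:+ S.con 1ℚ S.:* (S.con 1ℚ S.:* t)) S.:= t S.:+ S.con 1ℚ S.:* f) refl Vt Vf (indicator (pk ∧ not ap)))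
                          (signedSum-closed n true false d a ld' la')
  go false true pk ap = trans (S.solve 3 (λ t f i → S.con 1ℚ S.:* (S.con 1ℚ S.:* t) S.:+ S.con 1ℚ S.:* (S.con 0ℚ S.:* f) S.:+ i S.:*
      (S.con 0ℚ S.:* (S.con (- 1ℚ) S.:* t) S.:+ S.con 1ℚ S.:* (S.con 0ℚ S.:* t)) S.:= t S.:+ S.con 0ℚ S.:* f) refl Vt Vf (indicator (pk ∧ not ap)))
                          (signedSum-closed n true true d a ld' la')
  go true true false ap = trans (S.solve 2 (λ t f → S.con 1ℚ S.:* (S.con 1ℚ S.:* t) S.:+ S.con 0ℚ S.:* (S.con 0ℚ S.:* f) S.:+ S.con 0ℚ S.:*
      (S.con 0ℚ S.:* (S.con (- 1ℚ) S.:* t) S.:+ S.con 0ℚ S.:* (S.con 0ℚ S.:* t)) S.:= t S.:+ S.con 0ℚ S.:* f) refl Vt Vf)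
                          (signedSum-closed n false true d a ld' la')
  go true true true ap = trans (S.solve 3 (λ t f i → S.con 1ℚ S.:* (S.con 1ℚ S.:* t) S.:+ S.con 0ℚ S.:* (S.con 0ℚ S.:* f) S.:+ i S.:*
      (S.con 0ℚ S.:* (S.con (- 1ℚ) S.:* t) S.:+ S.con 0ℚ S.:* (S.con 0ℚ S.:* t)) S.:= t S.:+ S.con 0ℚ S.:* f) refl Vt Vf (indicator (not ap)))
                          (signedSum-closed n false true d a ld' la')
  go true false false ap = trans (S.solve 2 (λ t f → S.con 1ℚ S.:* (S.con 1ℚ S.:* t) S.:+ S.con 0ℚ S.:* (S.con 1ℚ S.:* f) S.:+ S.con 0ℚ S.:*
      (S.con 1ℚ S.:* (S.con (- 1ℚ) S.:* t) S.:+ S.con 0ℚ S.:* (S.con 1ℚ S.:* t)) S.:= t S.:+ S.con 0ℚ S.:* f) refl Vt Vf)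
                          (signedSum-closed n false false d a ld' la')
  go true false true true = trans (S.solve 2 (λ t f → S.con 1ℚ S.:* (S.con 1ℚ S.:* t) S.:+ S.con 0ℚ S.:* (S.con 1ℚ S.:* f) S.:+ S.con 0ℚ S.:*
      (S.con 1ℚ S.:* (S.con (- 1ℚ) S.:* t) S.:+ S.con 0ℚ S.:* (S.con 1ℚ S.:* t)) S.:= t S.:+ S.con 0ℚ S.:* f) refl Vt Vf)
                          (signedSum-closed n false false d a ld' la')
  go true false true false = S.solve 2 (λ t f → S.con 1ℚ S.:* (S.con 1ℚ S.:* t) S.:+ S.con 0ℚ S.:* (S.con 1ℚ S.:* f) S.:+ S.con 1ℚ S.:*
      (S.con 1ℚ S.:* (S.con (- 1ℚ) S.:* t) S.:+ S.con 0ℚ S.:* (S.con 1ℚ S.:* t)) S.:= S.con 0ℚ) refl Vt Vf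

wt-unitCol : ∀ {ℓ} (i : Fin ℓ) → wt (unitCol i) ≡ 1
wt-unitCol {suc ℓ} Fin.zero = trans (cong wt (unitCol0 {ℓ})) (cong suc (wt-vzero {ℓ}))
wt-unitCol {suc ℓ} (Fin.suc i) = wt-unitCol i

E-unitWeights : ∀ {ℓ} (w : List (Fin ℓ)) → All (λ c → wt c ≡ 1) (E w)
E-unitWeights [] = []
E-unitWeights (i ∷ w) = wt-unitCol i ∷ E-unitWeights w

-- Step 7: the peak condition Pk(I) ⊆ D(J) ∪ (D(J)+1) in terms of flags

-- positions k, k+1, … of the cuts of a flag vector (this is D of a merge)
flagPositions : ℕ → List Bool → List ℕ
flagPositions k [] = []
flagPositions k (x ∷ a) = if x then k ∷ flagPositions (suc k) a else flagPositions (suc k) a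

≡ᵇ-refl : ∀ k → (k ≡ᵇ k) ≡ true
≡ᵇ-refl zero = refl
≡ᵇ-refl (suc k) = ≡ᵇ-refl k

≡ᵇ-ne : ∀ s k → s ≢ k → (s ≡ᵇ k) ≡ false
≡ᵇ-ne zero zero ne = ⊥-elim (ne refl)
≡ᵇ-ne zero (suc k) ne = refl
≡ᵇ-ne (suc s) zero ne = refl
≡ᵇ-ne (suc s) (suc k) ne = ≡ᵇ-ne s k (λ e → ne (cong suc e))

memB-suc : ∀ s L → memB (suc s) (map suc L) ≡ memB s L
memB-suc s [] = refl
memB-suc s (m ∷ L) = cong ((s ≡ᵇ m) ∨_) (memB-suc s L)

memB-lt : ∀ s k a → s ℕ.< k → memB s (flagPositions k a) ≡ false
memB-lt s k [] lt = refl
memB-lt s k (true ∷ a) lt rewrite ≡ᵇ-ne s k (λ e → NP.<-irrefl e lt) = memB-lt s (suc k) a (NP.m<n⇒m<1+n lt)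
memB-lt s k (false ∷ a) lt = memB-lt s (suc k) a (NP.m<n⇒m<1+n lt)

memB-k : ∀ k a → memB k (flagPositions k a) ≡ hd a
memB-k k [] = refl
memB-k k (true ∷ a) rewrite ≡ᵇ-refl k = refl
memB-k k (false ∷ a) = memB-lt k (suc k) a (NP.n<1+n k)

memB-ne : ∀ s k x a → s ≢ k → memB s (flagPositions k (x ∷ a)) ≡ memB s (flagPositions (suc k) a)
memB-ne s k true a ne rewrite ≡ᵇ-ne s k ne = refl
memB-ne s k false a ne = refl

-- the positions of Pk(I), read off from descentFlags I
peakPositions : ℕ → Bool → List Bool → List ℕ
peakPositions k pf [] = []
peakPositions k pf (x ∷ d) = if x ∧ pf then k ∷ peakPositions (suc k) (not x) d else peakPositions (suc k) (not x) d

allB-if : ∀ (P : ℕ → Bool) c k L → allB P (if c then k ∷ L else L) ≡ (if c then P k else true) ∧ allB P L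
allB-if P true k L = refl
allB-if P false k L = refl

peaks-covered : ∀ (A : List ℕ) n k pk ap d a → length d ≡ n → length a ≡ n →
  (∀ j → memB (k ℕ.+ j) A ≡ memB (k ℕ.+ j) (flagPositions k a)) → memB k (map suc A) ≡ ap →
  allB (λ s → memB s A ∨ memB s (map suc A)) (peakPositions k pk d) ≡ peakOK n pk ap d a
peaks-covered A zero k pk ap [] [] _ _ h1 h2 = refl
peaks-covered A (suc n) k pk ap (x ∷ d) (y ∷ a) ld la h1 h2 =
  trans (allB-if P (x ∧ pk) k (peakPositions (suc k) (not x) d))
  (cong₂ _∧_ (cong (λ z → if x ∧ pk then z else true) (cong₂ _∨_ (trans (trans (cong (λ z → memB z A) (sym (NP.+-identityʳ k))) (h1 0))
      (trans (cong (λ z → memB z (flagPositions k (y ∷ a))) (NP.+-identityʳ k)) (memB-k k (y ∷ a)))) h2))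
     (peaks-covered A n (suc k) (not x) y d a (NP.suc-injective ld) (NP.suc-injective la) h1' h2'))
  where
  P = λ s → memB s A ∨ memB s (map suc A)
  h1' : ∀ j → memB (suc k ℕ.+ j) A ≡ memB (suc k ℕ.+ j) (flagPositions (suc k) a)
  h1' j = trans (cong (λ z → memB z A) (sym (NP.+-suc k j))) (trans (h1 (suc j))
    (trans (memB-ne (k ℕ.+ suc j) k y a (λ e → NP.m+1+n≢m k (e))) (cong (λ z → memB z (flagPositions (suc k) a)) (NP.+-suc k j))))
  h2' : memB (suc k) (map suc A) ≡ y
  h2' = trans (memB-suc k A) (trans (cong (λ z → memB z A) (sym (NP.+-identityʳ k)))
      (trans (h1 0) (trans (cong (λ z → memB z (flagPositions k (y ∷ a))) (NP.+-identityʳ k)) (memB-k k (y ∷ a)))))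

D-merge : ∀ {ℓ} acc (e : Col ℓ) r a → All (λ c → wt c ≡ 1) r → length a ≡ length r → descGo acc (merge e r a) ≡ flagPositions (acc ℕ.+ wt e) a
D-merge acc e [] [] _ _ = refl
D-merge acc e (y ∷ r) (true ∷ a) (wy ∷ wr) la with merge-nonempty y r a
... | f , rs , eq = trans (cong (descGo acc) (cong (e ∷_) eq)) (cong ((acc ℕ.+ wt e) ∷_)
     (trans (cong (descGo (acc ℕ.+ wt e)) (sym eq)) (trans (D-merge (acc ℕ.+ wt e) y r a wr (NP.suc-injective la))
        (cong (λ z → flagPositions z a) (trans (cong ((acc ℕ.+ wt e) ℕ.+_) wy) (NP.+-comm (acc ℕ.+ wt e) 1))))))
D-merge acc e (y ∷ r) (false ∷ a) (wy ∷ wr) la = trans (cong (descGo acc) (merge-addHead e y r a))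
  (trans (D-merge acc (vadd e y) r a wr (NP.suc-injective la))
     (cong (λ z → flagPositions z a) (trans (cong (acc ℕ.+_) (trans (wt-vadd e y) (cong (wt e ℕ.+_) wy)))
        (trans (sym (NP.+-assoc acc (wt e) 1)) (NP.+-comm (acc ℕ.+ wt e) 1)))))

peakPositions-falses : ∀ k pf m → peakPositions k pf (replicate m false) ≡ []
peakPositions-falses k pf zero = refl
peakPositions-falses k pf (suc m) = peakPositions-falses (suc k) true m

peakPositions-falses-++ : ∀ k pf m L → peakPositions k pf (replicate (suc m) false ++ L) ≡ peakPositions (k ℕ.+ suc m) true L
peakPositions-falses-++ k pf zero L = cong (λ z → peakPositions z true L) (NP.+-comm 1 k)
peakPositions-falses-++ k pf (suc m) L = trans (peakPositions-falses-++ (suc k) true m L) (cong (λ z → peakPositions z true L) (sym (NP.+-suc k (suc m))))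

Pk-descentFlags : ∀ {ℓ} acc (I : VC ℓ) → IsVComp I → pkGo acc I ≡ peakPositions (suc acc) false (descentFlags I)
Pk-descentFlags acc [] _ = refl
Pk-descentFlags acc (x ∷ []) _ = sym (peakPositions-falses (suc acc) false (wt x ∸ 1))
Pk-descentFlags acc (x ∷ y ∷ I) (px ∷ vI) = go (wt x) refl px
  where
  go : ∀ w → wt x ≡ w → 0 ℕ.< w → pkGo acc (x ∷ y ∷ I) ≡ peakPositions (suc acc) false (replicate (w ∸ 1) false ++ true ∷ descentFlags (y ∷ I))
  go (suc zero) ew _ rewrite ew = trans (cong (λ z → pkGo z (y ∷ I)) (NP.+-comm acc 1)) (Pk-descentFlags (suc acc) (y ∷ I) vI)
  go (suc (suc m)) ew _ rewrite ew = trans (cong₂ _∷_ p (trans (Pk-descentFlags (acc ℕ.+ suc (suc m)) (y ∷ I) vI)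
      (cong (λ z → peakPositions (suc z) false (descentFlags (y ∷ I))) p)))
    (sym (peakPositions-falses-++ (suc acc) false m (true ∷ descentFlags (y ∷ I))))
    where p = NP.+-suc acc (suc m)

length-cw : ∀ {ℓ} (I : VC ℓ) → length (cw I) ≡ totwt I
length-cw [] = refl
length-cw (x ∷ I) = trans (LP.length-++ (cwCol x)) (cong₂ ℕ._+_ (length-cwCol x) (length-cw I))

length-descentFlags : ∀ {ℓ} (x : Col ℓ) I → IsVComp (x ∷ I) → length (descentFlags (x ∷ I)) ≡ totwt (x ∷ I) ∸ 1
length-descentFlags x [] (px ∷ _) = trans (LP.length-replicate (wt x ∸ 1)) (cong (_∸ 1) (sym (NP.+-identityʳ (wt x))))
length-descentFlags x (y ∷ I) (px ∷ vI@(py ∷ _)) = trans (LP.length-++ (replicate (wt x ∸ 1) false))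
  (trans (cong₂ (λ u v → u ℕ.+ suc v) (LP.length-replicate (wt x ∸ 1)) (length-descentFlags y I vI))
      (ar (wt x) (totwt (y ∷ I)) px (NP.<-≤-trans py (NP.m≤m+n (wt y) (totwt I)))))
  where ar : ∀ a b → 0 ℕ.< a → 0 ℕ.< b → (a ∸ 1) ℕ.+ suc (b ∸ 1) ≡ a ℕ.+ b ∸ 1
        ar (suc a) (suc b) _ _ = refl

peakCondition-flags : ∀ {ℓ} (I : VC ℓ) (e : Col ℓ) r → IsVComp I → wt e ≡ 1 → All (λ c → wt c ≡ 1) r →
  length (descentFlags I) ≡ length r → ∀ a → length a ≡ length r →
  allB (λ s → memB s (D (merge e r a)) ∨ memB s (map suc (D (merge e r a)))) (Pk I) ≡ peakOK (length r) false false (descentFlags I) a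
peakCondition-flags I e r vI we wr ld a la rewrite Pk-descentFlags 0 I vI | D-merge 0 e r a wr la | we =
  peaks-covered (flagPositions 1 a) (length r) 1 false false (descentFlags I) a ld la (λ j → refl)
    (trans (memB-suc 0 (flagPositions 1 a)) (memB-lt 0 1 a (ℕ.s≤s ℕ.z≤n)))

-- Step 8: Σ_{I ≼ R} thetaM R = thetaF I

thetaF-coeff-nil : ∀ {ℓ} (J : VC ℓ) → sumℚ (map (λ R → thetaMCoeff R J) (refinements {ℓ} [])) ≡ coeff (thetaF {ℓ} []) J
thetaF-coeff-nil [] = refl
thetaF-coeff-nil (j ∷ J) = refl

-- The colouring word of a nonempty I = x I' (with cw(x) = i w) as single
-- letters E_{cw(I)} = e r, and its descent flags d.
module ColouringWord {ℓ} (x : Col ℓ) (I' : VC ℓ) (vI : IsVComp (x ∷ I'))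
                     (i : Fin ℓ) (w : List (Fin ℓ)) (cx : cwCol x ≡ i ∷ w) where
  I = x ∷ I'
  e = unitCol i
  r = E w ++ E (cw I')
  n = length r
  d = descentFlags I

  E-cw : E (cw I) ≡ e ∷ r
  E-cw = trans (LP.map-++ unitCol (cwCol x) (cw I')) (cong (λ z → E z ++ E (cw I')) cx)

  letters : All (λ c → wt c ≡ 1) (e ∷ r)
  letters = subst (All (λ c → wt c ≡ 1)) E-cw (E-unitWeights (cw I))

  length-d : length d ≡ n
  length-d = trans (length-descentFlags x I' vI)
    (cong (_∸ 1) (trans (sym (length-cw I)) (trans (sym (LP.length-map unitCol (cw I))) (cong length E-cw))))

  isJ : VC ℓ → List Bool → Bool
  isJ J a = does (J ≟VC merge e r a)

  refinementTerm : ∀ J b →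
    indicator (flagsLe d b) * thetaMCoeff (merge e r b) J ≡ sumFlags n (λ a → pow2 (length J) * (indicator (isJ J a) * signedTerm e r d a b))
  refinementTerm J b = begin
    indicator (flagsLe d b) * thetaMCoeff (merge e r b) J
      ≡⟨ cong (indicator (flagsLe d b) *_) (thetaMCoeff-merge e r b J) ⟩
    indicator (flagsLe d b) * (indicator (lastOddFlag e r b) * (Sg * (Pw * sumFlags n Z)))
      ≡⟨ S.solve 5 (λ D L G P Z → D S.:* (L S.:* (G S.:* (P S.:* Z))) S.:= (D S.:* L S.:* G S.:* P) S.:* Z) refl
           (indicator (flagsLe d b)) (indicator (lastOddFlag e r b)) Sg Pw (sumFlags n Z) ⟩
    (indicator (flagsLe d b) * indicator (lastOddFlag e r b) * Sg * Pw) * sumFlags n Z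
      ≡⟨ sym (sum-scale (indicator (flagsLe d b) * indicator (lastOddFlag e r b) * Sg * Pw) Z (allFlags n)) ⟩
    sumFlags n (λ a → (indicator (flagsLe d b) * indicator (lastOddFlag e r b) * Sg * Pw) * Z a)
      ≡⟨ sumFlags-cong n _ _ (λ a → S.solve 6 (λ D L G P A Q → D S.:* L S.:* G S.:* P S.:* (A S.:* Q) S.:= P S.:* (Q S.:* (D S.:* (L S.:* (A S.:* G))))) refl
           (indicator (flagsLe d b)) (indicator (lastOddFlag e r b)) Sg Pw (indicator (flagsLe a (oddFlags e r b))) (indicator (isJ J a))) ⟩
    sumFlags n (λ a → Pw * (indicator (isJ J a) * signedTerm e r d a b)) ∎
    where
    open ≡-Reasoning
    Pw = pow2 (length J)
    Sg = sign (length (merge e r b) ℕ.+ totwt (merge e r b))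
    Z = λ a → indicator (flagsLe a (oddFlags e r b)) * indicator (isJ J a)

  refinementSum-flags : ∀ J → sumℚ (map (λ R → thetaMCoeff R J) (refinements I)) ≡
    pow2 (length J) * sumFlags n (λ a → indicator (isJ J a) * signedSum e r d a)
  refinementSum-flags J = begin
    sumℚ (map (λ R → thetaMCoeff R J) (refinements I))
      ≡⟨ refinements-flags x I' i w cx (All.tail vI) (λ R → thetaMCoeff R J) ⟩
    sumFlags n (λ b → indicator (flagsLe d b) * thetaMCoeff (merge e r b) J)
      ≡⟨ sumFlags-cong n _ _ (refinementTerm J) ⟩
    sumFlags n (λ b → sumFlags n (λ a → Pw * (indicator (isJ J a) * signedTerm e r d a b)))
      ≡⟨ sum-swap (λ b a → Pw * (indicator (isJ J a) * signedTerm e r d a b)) (allFlags n) (allFlags n) ⟩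
    sumFlags n (λ a → sumFlags n (λ b → Pw * (indicator (isJ J a) * signedTerm e r d a b)))
      ≡⟨ sumFlags-cong n _ _ (λ a → trans (sum-scale Pw _ (allFlags n)) (cong (Pw *_) (sum-scale (indicator (isJ J a)) (signedTerm e r d a) (allFlags n)))) ⟩
    sumFlags n (λ a → Pw * (indicator (isJ J a) * signedSum e r d a))
      ≡⟨ sum-scale Pw _ (allFlags n) ⟩
    Pw * sumFlags n (λ a → indicator (isJ J a) * signedSum e r d a) ∎
    where
    open ≡-Reasoning
    Pw = pow2 (length J)

  signedSum-peak : ∀ a → length a ≡ n → signedSum e r d a ≡ indicator (peakOK n false false d a)
  signedSum-peak a la = begin
    signedSum e r d a                   ≡⟨ signedSum-unitColumns e r d a (All.tail letters) ⟩
    signedSumP (isOdd (wt e)) n d a     ≡⟨ cong (λ p → signedSumP (isOdd p) n d a) (All.head letters) ⟩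
    signedSumP true n d a               ≡⟨ sym (trans (cong (signedSumP true n d a +_) (QP.*-zeroˡ (signedSumP false n d a))) (QP.+-identityʳ _)) ⟩
    signedSumP true n d a + indicator (false ∧ not false) * signedSumP false n d a
                                        ≡⟨ signedSum-closed n false false d a length-d la ⟩
    indicator (peakOK n false false d a) ∎
    where open ≡-Reasoning

  thetaF-flags : ∀ J → coeff (thetaF I) J ≡ pow2 (length J) * sumFlags n (λ a → indicator (isJ J a) * indicator (peakOK n false false d a))
  thetaF-flags J = begin
    coeff (thetaF I) J
      ≡⟨ coeff-mapP (filterB peaks (coarsenings (E (cw I)))) J ⟩
    Pw * sumℚ (map (λ J' → indicator (does (J ≟VC J'))) (filterB peaks (coarsenings (E (cw I)))))
      ≡⟨ cong (Pw *_) (sum-filter peaks (λ J' → indicator (does (J ≟VC J'))) (coarsenings (E (cw I)))) ⟩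
    Pw * sumℚ (map (λ J' → indicator (peaks J') * indicator (does (J ≟VC J'))) (coarsenings (E (cw I))))
      ≡⟨ cong (λ z → Pw * sumℚ (map (λ J' → indicator (peaks J') * indicator (does (J ≟VC J'))) (coarsenings z))) E-cw ⟩
    Pw * sumℚ (map (λ J' → indicator (peaks J') * indicator (does (J ≟VC J'))) (coarsenings (e ∷ r)))
      ≡⟨ cong (Pw *_) (coarsenings-flags e r (λ J' → indicator (peaks J') * indicator (does (J ≟VC J')))) ⟩
    Pw * sumFlags n (λ a → indicator (peaks (merge e r a)) * indicator (isJ J a))
      ≡⟨ cong (Pw *_) (sumFlags-congL n _ _ (λ a la → trans (QP.*-comm (indicator (peaks (merge e r a))) (indicator (isJ J a)))
           (cong (λ z → indicator (isJ J a) * indicator z) (peakCondition-flags I e r vI (All.head letters) (All.tail letters) length-d a la)))) ⟩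
    Pw * sumFlags n (λ a → indicator (isJ J a) * indicator (peakOK n false false d a)) ∎
    where
    open ≡-Reasoning
    Pw = pow2 (length J)
    peaks = λ J' → allB (λ s → memB s (D J') ∨ memB s (map suc (D J'))) (Pk I)

thetaF-coeff : ∀ {ℓ} (I : VC ℓ) → IsVComp I → ∀ J → sumℚ (map (λ R → thetaMCoeff R J) (refinements I)) ≡ coeff (thetaF I) J
thetaF-coeff [] _ J = thetaF-coeff-nil J
thetaF-coeff (x ∷ I') vI J with cwCol-nonempty x (All.head vI)
... | i , w , cx = begin
  sumℚ (map (λ R → thetaMCoeff R J) (refinements (x ∷ I')))
    ≡⟨ refinementSum-flags J ⟩
  pow2 (length J) * sumFlags n (λ a → indicator (isJ J a) * signedSum e r d a)
    ≡⟨ cong (pow2 (length J) *_) (sumFlags-congL n _ _ (λ a la → cong (indicator (isJ J a) *_) (signedSum-peak a la))) ⟩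
  pow2 (length J) * sumFlags n (λ a → indicator (isJ J a) * indicator (peakOK n false false d a))
    ≡⟨ sym (thetaF-flags J) ⟩
  coeff (thetaF (x ∷ I')) J ∎
  where
  open ≡-Reasoning
  open ColouringWord x I' vI i w cx

module ThetaOnBases {ℓ} (Θ : VC ℓ → Lin ℓ) (isΘ : IsTheta Θ) where
  open ThetaDetermined Θ isΘ

  coeff-Θ : ∀ R J → IsVComp R → coeff (Θ R) J ≡ thetaMCoeff R J
  coeff-Θ R J vR = trans (coeff-Θ-forced R J vR) (forcedCoeff-thetaM J R)

  theta-on-M : ∀ I → IsVComp I → linExt Θ (M I) ≈ thetaM I
  theta-on-M I vI J = begin
    coeff (linExt Θ (M I)) J      ≡⟨ coeff-linExt Θ (M I) J ⟩
    1ℚ * coeff (Θ I) J + 0ℚ       ≡⟨ trans (QP.+-identityʳ _) (QP.*-identityˡ _) ⟩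
    coeff (Θ I) J                 ≡⟨ coeff-Θ I J vI ⟩
    thetaMCoeff I J               ≡⟨ sym (coeff-thetaM I J) ⟩
    coeff (thetaM I) J ∎
    where open ≡-Reasoning

  theta-on-F : ∀ I → IsVComp I → linExt Θ (F I) ≈ thetaF I
  theta-on-F I vI J = begin
    coeff (linExt Θ (F I)) J
      ≡⟨ trans (coeff-linExt Θ (F I) J) (sum-map (uncurry (λ q K → q * coeff (Θ K) J)) (λ R → (1ℚ , R)) (refinements I)) ⟩
    sumℚ (map (λ R → 1ℚ * coeff (Θ R) J) (refinements I))
      ≡⟨ sum-cong-All (λ R → 1ℚ * coeff (Θ R) J) (λ R → thetaMCoeff R J) (refinements I) (refinements-IsVComp I)
           (λ R vR → trans (QP.*-identityˡ _) (coeff-Θ R J vR)) ⟩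
    sumℚ (map (λ R → thetaMCoeff R J) (refinements I))
      ≡⟨ thetaF-coeff I vI J ⟩
    coeff (thetaF I) J ∎
    where open ≡-Reasoning

proposition6p4 : (ℓ : ℕ) → 1 ≤ ℓ → (Θ : VC ℓ → Lin ℓ) → IsTheta Θ →
  (I : VC ℓ) → IsVComp I →
  (linExt Θ (M I) ≈ thetaM I) × (linExt Θ (F I) ≈ thetaF I)
proposition6p4 ℓ _ Θ isΘ I vI = theta-on-M I vI , theta-on-F I vI
  where open ThetaOnBases Θ isΘ
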